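{- Let $C=(c_1,\dots,c_n)\in\mathrm{Mat}_{m\times n}(\mathbb{Z})$ have nonzero columns. For $q\in\mathbb{Z}_{>0}$ let $H_{j,q}=\{x\in\mathbb{Z}_q^m: x[c_j]_q=[0]_q\}$, $H_{J,q}=\bigcap_{j\in J}H_{j,q}$ for $J\subseteq\{1,\dots,n\}$ (with $H_{\emptyset,q}=\mathbb{Z}_q^m$), and let $L_q$ be the intersection lattice of $\mathcal{A}_q=\{H_{j,q}\}$, i.e., the set $\{H_{J,q}:J\subseteq\{1,\dots,n\}\}$ ordered by reverse inclusion. Let $\rho_0$ and $q_0$ be defined by $$\rho_0=\operatorname{lcm}\{e(J):1\le|J|\le\min\{m,n\}\},\qquad q_0=\max_{\emptyset\ne J\subseteq\{1,\dots,n\}}\ \min_{S_J}\ \max\{|u|: u \text{ is an entry of } S_JC \text{ or of } C\},$$ where $e(J)$ is the largest elementary divisor of the submatrix $C_J$ formed by the columns indexed by $J$, and for each $J$ the minimum runs over all unimodular $S_J$ for which some unimodular $T_J$ makes $S_JC_JT_J$ the Smith normal form of $C_J$. Then $L_q$ is periodic in $q>q_0$ with period $\rho_0$: $L_{q+s\rho_0}\simeq L_q$ for all $q>q_0$ and $s\in\mathbb{Z}_{\ge0}$.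
   Context: $\mathbb{Z}_q=\mathbb{Z}/q\mathbb{Z}$; $[c_j]_q$ is the reduction of $c_j$ mod $q$. The Smith normal form of an integer matrix $G$ of rank $\ell$ is $SGT=\begin{pmatrix}\mathrm{diag}(e_1,\dots,e_\ell)&O\\O&O\end{pmatrix}$ with $S,T$ unimodular and $e_1|\cdots|e_\ell$ positive integers (elementary divisors); the largest is $e_\ell$. $\simeq$ denotes isomorphism of posets (lattices). -}

module Defs where

open import Data.Nat as ℕ using (ℕ; zero; suc; _≤_; _<_; _⊓_; _≟_; _<?_)
open import Data.Integer as ℤ using (ℤ; +_; 0ℤ; 1ℤ; ∣_∣)
open import Data.Integer.Divisibility using () renaming (_∣_ to _∣ℤ_)
open import Data.Nat.Divisibility using (_∣_)
open import Data.Fin using (Fin; zero; suc; toℕ; fromℕ<)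
open import Data.Vec using (Vec; []; _∷_; lookup)
open import Data.Sum using (_⊎_)
open import Data.Bool using (Bool; true; false)
open import Data.Product using (Σ; ∃; ∃-syntax; _×_; _,_)
open import Relation.Binary.PropositionalEquality using (_≡_)
open import Relation.Nullary using (¬_; yes; no)

Mat : ℕ → ℕ → Set
Mat m n = Fin m → Fin n → ℤ

Σℤ : ∀ {k} → (Fin k → ℤ) → ℤ
Σℤ {zero}  f = 0ℤ
Σℤ {suc k} f = f zero ℤ.+ Σℤ (λ i → f (suc i))

_⊗_ : ∀ {m k n} → Mat m k → Mat k n → Mat m n
(A ⊗ B) i j = Σℤ (λ l → A i l ℤ.* B l j)

_≈M_ : ∀ {m n} → Mat m n → Mat m n → Set
A ≈M B = ∀ i j → A i j ≡ B i j

idM : ∀ {m} → Mat m m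
idM i j with toℕ i ≟ toℕ j
... | yes _ = 1ℤ
... | no  _ = 0ℤ

Unimodular : ∀ {m} → Mat m m → Set
Unimodular {m} S = Σ (Mat m m) λ S' → (S ⊗ S') ≈M idM × (S' ⊗ S) ≈M idM

record SNFData (m k : ℕ) : Set where
  field
    ℓ     : ℕ
    ℓ≤m   : ℓ ≤ m
    ℓ≤k   : ℓ ≤ k
    e     : Fin ℓ → ℕ
    e-pos : ∀ i → 0 < e i
    chain : ∀ (i j : Fin ℓ) → toℕ i ≤ toℕ j → e i ∣ e j

snfMat : ∀ {m k} → SNFData m k → Mat m k
snfMat D i j with toℕ i ≟ toℕ j | toℕ i <? SNFData.ℓ D
... | yes _ | yes p = + SNFData.e D (fromℕ< p)
... | yes _ | no  _ = 0ℤ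
... | no  _ | _     = 0ℤ

IsSNFVia : ∀ {m k} → Mat m k → Mat m m → Mat k k → SNFData m k → Set
IsSNFVia A S T D = Unimodular S × Unimodular T × ((S ⊗ A) ⊗ T) ≈M snfMat D

LargestElemDiv : ∀ {m k} → Mat m k → ℕ → Set
LargestElemDiv {m} {k} A e =
  Σ (Mat m m) λ S → Σ (Mat k k) λ T → Σ (SNFData m k) λ D →
    IsSNFVia A S T D ×
    Σ (Fin (SNFData.ℓ D)) λ i → suc (toℕ i) ≡ SNFData.ℓ D × SNFData.e D i ≡ e

card : ∀ {n} → Vec Bool n → ℕ
card []          = 0
card (true ∷ J)  = suc (card J)
card (false ∷ J) = card J

sel : ∀ {n} (J : Vec Bool n) → Fin (card J) → Fin n
sel (true ∷ J)  zero    = zero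
sel (true ∷ J)  (suc k) = suc (sel J k)
sel (false ∷ J) k       = suc (sel J k)

_∈J_ : ∀ {n} → Fin n → Vec Bool n → Set
j ∈J J = lookup J j ≡ true

sub : ∀ {m n} → Mat m n → (J : Vec Bool n) → Mat m (card J)
sub C J i k = C i (sel J k)

NonzeroColumns : ∀ {m n} → Mat m n → Set
NonzeroColumns C = ∀ j → ¬ (∀ i → C i j ≡ 0ℤ)

IsRho0 : ∀ {m n} → Mat m n → ℕ → Set
IsRho0 {m} {n} C ρ =
  (∀ (J : Vec Bool n) e → 1 ≤ card J → card J ≤ m ⊓ n →
     LargestElemDiv (sub C J) e → e ∣ ρ) ×
  (∀ M → (∀ (J : Vec Bool n) e → 1 ≤ card J → card J ≤ m ⊓ n →
            LargestElemDiv (sub C J) e → e ∣ M) → ρ ∣ M)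

MaxEntry : ∀ {m n} → Mat m n → Mat m m → ℕ → Set
MaxEntry C S v =
  (∀ i j → ∣ (S ⊗ C) i j ∣ ≤ v × ∣ C i j ∣ ≤ v) ×
  (∃[ i ] ∃[ j ] (∣ (S ⊗ C) i j ∣ ≡ v ⊎ ∣ C i j ∣ ≡ v))

AdmissibleS : ∀ {m n} → Mat m n → (J : Vec Bool n) → Mat m m → Set
AdmissibleS C J S = Σ _ λ T → Σ _ λ D → IsSNFVia (sub C J) S T D

IsMinCost : ∀ {m n} → Mat m n → Vec Bool n → ℕ → Set
IsMinCost C J w =
  (Σ _ λ S → AdmissibleS C J S × MaxEntry C S w) ×
  (∀ S v → AdmissibleS C J S → MaxEntry C S v → w ≤ v)

IsQ0 : ∀ {m n} → Mat m n → ℕ → Set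
IsQ0 {m} {n} C q0 =
  (∀ (J : Vec Bool n) w → 1 ≤ card J → IsMinCost C J w → w ≤ q0) ×
  (1 ≤ n → ∃[ J ] (1 ≤ card J × IsMinCost C J q0))

-- The arrangement over ℤ_q (elements of ℤ_q represented by Fin q)

InH : ∀ {m n} → Mat m n → (q : ℕ) → Vec Bool n → (Fin m → Fin q) → Set
InH C q J x = ∀ j → j ∈J J → (+ q) ∣ℤ Σℤ (λ i → (+ toℕ (x i)) ℤ.* C i j)

_⊆H[_,_]_ : ∀ {m n} → Vec Bool n → Mat m n → ℕ → Vec Bool n → Set
J ⊆H[ C , q ] J' = ∀ x → InH C q J x → InH C q J' x

_≤L[_,_]_ : ∀ {m n} → Vec Bool n → Mat m n → ℕ → Vec Bool n → Set
J ≤L[ C , q ] J' = J' ⊆H[ C , q ] J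

_≡H[_,_]_ : ∀ {m n} → Vec Bool n → Mat m n → ℕ → Vec Bool n → Set
J ≡H[ C , q ] J' = J ⊆H[ C , q ] J' × J' ⊆H[ C , q ] J

-- Elements of L_q are the sets H_{J,q}, represented
-- by J; φ acts on representatives, is an order embedding (hence well
-- defined and injective on the sets H_{J,q}) and is surjective onto L_q'.
LatticeIso : ∀ {m n} → Mat m n → ℕ → ℕ → Set
LatticeIso {m} {n} C q q' =
  Σ (Vec Bool n → Vec Bool n) λ φ →
    (∀ J J' → (J ≤L[ C , q ] J' → φ J ≤L[ C , q' ] φ J') ×
              (φ J ≤L[ C , q' ] φ J' → J ≤L[ C , q ] J')) ×
    (∀ K → ∃[ J ] (φ J ≡H[ C , q' ] K))

module Submission where

-- Fix J′ and a Smith decomposition S C_J′ T = diag(e₁, …, e_ℓ), and put B = S C and y = x S⁻¹.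
-- Then x ∈ H_{J′,q} iff q ∣ yᵢ eᵢ for every i (with eᵢ = 0 for i > ℓ), while x c_j = Σᵢ yᵢ b_ij.
-- So H_{J′,q} ⊆ H_{J,q} iff for all j ∈ J and all i the annihilator of eᵢ in ℤ_q lies in that of
-- b_ij, i.e. gcd(q, eᵢ) ∣ b_ij. Every eᵢ divides ρ₀ (when |J′| > m a kernel vector of C_J′ lets one
-- drop a column), so gcd(q, eᵢ) is ρ₀-periodic in q; and an S of least cost has |b_ij| ≤ q₀ < q,
-- which settles eᵢ = 0. Hence the inclusions among the H_{J,q} agree for q and q + sρ₀, and the
-- identity on index sets J is the isomorphism.

open import Defs
open import Data.Nat as ℕ using (ℕ; zero; suc; z≤n; s≤s; _≤_; _<_)
import Data.Nat.Properties as ℕₚ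
open import Data.Nat.Divisibility using (_∣_; _∣?_; divides; ∣-refl; ∣-trans)
open import Data.Integer as ℤ using (ℤ; +_; -_; 0ℤ; 1ℤ; ∣_∣)
import Data.Integer.Properties as ℤₚ
open import Data.Integer.Tactic.RingSolver using (solve-∀)
import Data.Integer.Divisibility.Signed as ℤ∣
open ℤ∣ using () renaming (_∣_ to _∣ℤ_)
open import Data.Fin as Fin using (Fin; zero; suc; toℕ; fromℕ<; inject≤)
import Data.Fin.Properties as Finₚ
open import Data.Vec using (Vec; []; _∷_; lookup)
open import Data.Bool using (Bool; true; false)
open import Data.Product using (∃; ∃-syntax; _×_; _,_; proj₁; proj₂)
open import Data.Sum using (_⊎_; inj₁; inj₂)
open import Data.Empty using (⊥-elim)
open import Function using (_∘_; _$_)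
open import Function.Bundles using (_⇔_; mk⇔; Equivalence)
open import Relation.Binary.PropositionalEquality
open import Relation.Nullary using (¬_; Dec; yes; no)

all-or-counterexample : ∀ {k} {P : Fin k → Set} → (∀ i → Dec (P i)) → (∀ i → P i) ⊎ ∃ (¬_ ∘ P)
all-or-counterexample P? with Finₚ.all? P?
... | yes ∀P = inj₁ ∀P
... | no ¬∀P = inj₂ (Finₚ.¬∀⟶∃¬ _ _ P? ¬∀P)

all-or-counterexample₂ : ∀ {m k} {P : Fin m → Fin k → Set} → (∀ i j → Dec (P i j)) →
  (∀ i j → P i j) ⊎ ∃[ i ] ∃[ j ] ¬ P i j
all-or-counterexample₂ P? with all-or-counterexample (λ i → Finₚ.all? (P? i))
... | inj₁ ∀P         = inj₁ ∀P
... | inj₂ (i , ¬∀Pi) with all-or-counterexample (P? i)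
...   | inj₁ ∀Pi        = ⊥-elim (¬∀Pi ∀Pi)
...   | inj₂ (j , ¬Pij) = inj₂ (i , j , ¬Pij)

module MatrixAlgebra where

  open import Data.Integer using (_+_; _*_)

  δ : ∀ {m} → Fin m → Fin m → ℤ
  δ zero    zero    = 1ℤ
  δ zero    (suc _) = 0ℤ
  δ (suc _) zero    = 0ℤ
  δ (suc i) (suc j) = δ i j

  δ-refl : ∀ {m} (i : Fin m) → δ i i ≡ 1ℤ
  δ-refl zero    = refl
  δ-refl (suc i) = δ-refl i

  δ-≢ : ∀ {m} {i j : Fin m} → i ≢ j → δ i j ≡ 0ℤ
  δ-≢ {i = zero}  {zero}  i≢j = ⊥-elim (i≢j refl)
  δ-≢ {i = zero}  {suc j} i≢j = refl
  δ-≢ {i = suc i} {zero}  i≢j = refl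
  δ-≢ {i = suc i} {suc j} i≢j = δ-≢ (i≢j ∘ cong suc)

  δ-sym : ∀ {m} (i j : Fin m) → δ i j ≡ δ j i
  δ-sym zero    zero    = refl
  δ-sym zero    (suc j) = refl
  δ-sym (suc i) zero    = refl
  δ-sym (suc i) (suc j) = δ-sym i j

  idM≡δ : ∀ {m} (i j : Fin m) → idM i j ≡ δ i j
  idM≡δ i j with toℕ i ℕ.≟ toℕ j
  ... | yes i≡j rewrite Finₚ.toℕ-injective i≡j = sym (δ-refl j)
  ... | no  i≢j = sym (δ-≢ (i≢j ∘ cong toℕ))

  Σℤ-cong : ∀ {k} {f g : Fin k → ℤ} → (∀ i → f i ≡ g i) → Σℤ f ≡ Σℤ g
  Σℤ-cong {zero}  f≗g = refl
  Σℤ-cong {suc k} f≗g = cong₂ _+_ (f≗g zero) (Σℤ-cong (f≗g ∘ suc))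

  Σℤ-zero : ∀ {k} (f : Fin k → ℤ) → (∀ i → f i ≡ 0ℤ) → Σℤ f ≡ 0ℤ
  Σℤ-zero {zero}  f f≗0 = refl
  Σℤ-zero {suc k} f f≗0 =
    cong₂ _+_ (f≗0 zero) (Σℤ-zero (f ∘ suc) (f≗0 ∘ suc))

  Σℤ-+ : ∀ {k} (f g : Fin k → ℤ) → Σℤ (λ i → f i + g i) ≡ Σℤ f + Σℤ g
  Σℤ-+ {zero}  f g = refl
  Σℤ-+ {suc k} f g rewrite Σℤ-+ (f ∘ suc) (g ∘ suc) =
    middle-swap (f zero) (g zero) (Σℤ (f ∘ suc)) (Σℤ (g ∘ suc))
    where
    middle-swap : ∀ a b c d → (a + b) + (c + d) ≡ (a + c) + (b + d)
    middle-swap = solve-∀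

  Σℤ-*ˡ : ∀ {k} (a : ℤ) (f : Fin k → ℤ) → Σℤ (λ i → a * f i) ≡ a * Σℤ f
  Σℤ-*ˡ {zero}  a f = sym (ℤₚ.*-zeroʳ a)
  Σℤ-*ˡ {suc k} a f rewrite Σℤ-*ˡ a (f ∘ suc) =
    sym (ℤₚ.*-distribˡ-+ a (f zero) (Σℤ (f ∘ suc)))

  Σℤ-*ʳ : ∀ {k} (a : ℤ) (f : Fin k → ℤ) → Σℤ (λ i → f i * a) ≡ Σℤ f * a
  Σℤ-*ʳ a f = begin
    Σℤ (λ i → f i * a) ≡⟨ Σℤ-cong (λ i → ℤₚ.*-comm (f i) a) ⟩
    Σℤ (λ i → a * f i) ≡⟨ Σℤ-*ˡ a f ⟩
    a * Σℤ f           ≡⟨ ℤₚ.*-comm a (Σℤ f) ⟩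
    Σℤ f * a           ∎
    where open ≡-Reasoning

  Σℤ-neg : ∀ {k} (f : Fin k → ℤ) → Σℤ (λ i → - f i) ≡ - Σℤ f
  Σℤ-neg f = begin
    Σℤ (λ i → - f i)        ≡⟨ Σℤ-cong (λ i → sym (ℤₚ.-1*i≡-i (f i))) ⟩
    Σℤ (λ i → - 1ℤ * f i)   ≡⟨ Σℤ-*ˡ (- 1ℤ) f ⟩
    - 1ℤ * Σℤ f             ≡⟨ ℤₚ.-1*i≡-i (Σℤ f) ⟩
    - Σℤ f                  ∎
    where open ≡-Reasoning

  Σℤ-comm : ∀ {a b} (f : Fin a → Fin b → ℤ) →
    Σℤ (λ i → Σℤ (λ j → f i j)) ≡ Σℤ (λ j → Σℤ (λ i → f i j))
  Σℤ-comm {zero}  {b} f = sym (Σℤ-zero {b} (λ _ → 0ℤ) (λ _ → refl))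
  Σℤ-comm {suc a} f rewrite Σℤ-comm (f ∘ suc) =
    sym (Σℤ-+ (f zero) (λ j → Σℤ (λ i → f (suc i) j)))

  Σℤ-δˡ : ∀ {k} (i : Fin k) (f : Fin k → ℤ) → Σℤ (λ l → δ i l * f l) ≡ f i
  Σℤ-δˡ zero f = begin
    1ℤ * f zero + Σℤ (λ l → 0ℤ * f (suc l))
      ≡⟨ cong₂ _+_ (ℤₚ.*-identityˡ (f zero)) (Σℤ-zero _ (λ l → ℤₚ.*-zeroˡ (f (suc l)))) ⟩
    f zero + 0ℤ
      ≡⟨ ℤₚ.+-identityʳ (f zero) ⟩
    f zero ∎
    where open ≡-Reasoning
  Σℤ-δˡ (suc i) f = begin
    0ℤ * f zero + Σℤ (λ l → δ i l * f (suc l))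
      ≡⟨ cong (_+ Σℤ (λ l → δ i l * f (suc l))) (ℤₚ.*-zeroˡ (f zero)) ⟩
    0ℤ + Σℤ (λ l → δ i l * f (suc l))
      ≡⟨ ℤₚ.+-identityˡ _ ⟩
    Σℤ (λ l → δ i l * f (suc l))
      ≡⟨ Σℤ-δˡ i (f ∘ suc) ⟩
    f (suc i) ∎
    where open ≡-Reasoning

  Σℤ-δʳ : ∀ {k} (i : Fin k) (f : Fin k → ℤ) → Σℤ (λ l → f l * δ l i) ≡ f i
  Σℤ-δʳ i f = trans
    (Σℤ-cong (λ l → trans (ℤₚ.*-comm (f l) (δ l i)) (cong (_* f l) (δ-sym l i))))
    (Σℤ-δˡ i f)

  Σℤ-single : ∀ {k} (κ : Fin k) (g : Fin k → ℤ) → (∀ l → l ≢ κ → g l ≡ 0ℤ) → Σℤ g ≡ g κ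
  Σℤ-single κ g g≗0 = trans (Σℤ-cong g≡δ*g) (Σℤ-δˡ κ (λ _ → g κ))
    where
    g≡δ*g : ∀ l → g l ≡ δ κ l * g κ
    g≡δ*g l with l Finₚ.≟ κ
    ... | yes refl = sym (trans (cong (_* g l) (δ-refl l)) (ℤₚ.*-identityˡ (g l)))
    ... | no  l≢κ  = trans (g≗0 l l≢κ)
      (sym (trans (cong (_* g κ) (δ-≢ (l≢κ ∘ sym))) (ℤₚ.*-zeroˡ (g κ))))

  ∣-Σℤ : ∀ {k} {d : ℤ} (f : Fin k → ℤ) → (∀ i → d ∣ℤ f i) → d ∣ℤ Σℤ f
  ∣-Σℤ {zero}  f d∣f = ℤ∣.divides 0ℤ refl
  ∣-Σℤ {suc k} f d∣f = ℤ∣.∣m∣n⇒∣m+n (d∣f zero) (∣-Σℤ (f ∘ suc) (d∣f ∘ suc))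

  ≈M-refl : ∀ {m n} {A : Mat m n} → A ≈M A
  ≈M-refl i j = refl

  ≈M-sym : ∀ {m n} {A B : Mat m n} → A ≈M B → B ≈M A
  ≈M-sym A≈B i j = sym (A≈B i j)

  ≈M-trans : ∀ {m n} {A B C : Mat m n} → A ≈M B → B ≈M C → A ≈M C
  ≈M-trans A≈B B≈C i j = trans (A≈B i j) (B≈C i j)

  ⊗-cong : ∀ {m k n} {A A' : Mat m k} {B B' : Mat k n} → A ≈M A' → B ≈M B' → (A ⊗ B) ≈M (A' ⊗ B')
  ⊗-cong A≈A' B≈B' i j = Σℤ-cong (λ l → cong₂ _*_ (A≈A' i l) (B≈B' l j))

  ⊗-congˡ : ∀ {m k n} (A : Mat m k) {B B' : Mat k n} → B ≈M B' → (A ⊗ B) ≈M (A ⊗ B')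
  ⊗-congˡ A = ⊗-cong (≈M-refl {A = A})

  ⊗-congʳ : ∀ {m k n} {A A' : Mat m k} (B : Mat k n) → A ≈M A' → (A ⊗ B) ≈M (A' ⊗ B)
  ⊗-congʳ B A≈A' = ⊗-cong A≈A' (≈M-refl {A = B})

  ⊗-assoc : ∀ {m k p n} (A : Mat m k) (B : Mat k p) (C : Mat p n) → ((A ⊗ B) ⊗ C) ≈M (A ⊗ (B ⊗ C))
  ⊗-assoc A B C i j = begin
    Σℤ (λ l → Σℤ (λ p → A i p * B p l) * C l j)
      ≡⟨ Σℤ-cong (λ l → sym (Σℤ-*ʳ (C l j) (λ p → A i p * B p l))) ⟩
    Σℤ (λ l → Σℤ (λ p → A i p * B p l * C l j))
      ≡⟨ Σℤ-comm (λ l p → A i p * B p l * C l j) ⟩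
    Σℤ (λ p → Σℤ (λ l → A i p * B p l * C l j))
      ≡⟨ Σℤ-cong (λ p → trans (Σℤ-cong (λ l → ℤₚ.*-assoc (A i p) (B p l) (C l j)))
                                (Σℤ-*ˡ (A i p) (λ l → B p l * C l j))) ⟩
    Σℤ (λ p → A i p * Σℤ (λ l → B p l * C l j)) ∎
    where open ≡-Reasoning

  ⊗-identityˡ : ∀ {m n} (A : Mat m n) → (idM ⊗ A) ≈M A
  ⊗-identityˡ A i j = trans (Σℤ-cong (λ l → cong (_* A l j) (idM≡δ i l))) (Σℤ-δˡ i (λ l → A l j))

  ⊗-identityʳ : ∀ {m n} (A : Mat m n) → (A ⊗ idM) ≈M A
  ⊗-identityʳ A i j = trans (Σℤ-cong (λ l → cong (A i l *_) (idM≡δ l j))) (Σℤ-δʳ j (A i))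

  ⊗-cancel : ∀ {m k n} (A : Mat m k) {B B' : Mat k k} (C : Mat k n) →
             (B ⊗ B') ≈M idM → (((A ⊗ B) ⊗ B') ⊗ C) ≈M (A ⊗ C)
  ⊗-cancel A {B} {B'} C BB'≈I = ⊗-congʳ C
    (≈M-trans (⊗-assoc A B B') (≈M-trans (⊗-congˡ A BB'≈I) (⊗-identityʳ A)))

  Unimodular-idM : ∀ {m} → Unimodular (idM {m})
  Unimodular-idM = idM , ⊗-identityˡ idM , ⊗-identityˡ idM

  Unimodular-⊗ : ∀ {m} {S U : Mat m m} → Unimodular S → Unimodular U → Unimodular (U ⊗ S)
  Unimodular-⊗ {S = S} {U} (S' , SS'≈I , S'S≈I) (U' , UU'≈I , U'U≈I) =
    S' ⊗ U' , inverse U S S' U' SS'≈I UU'≈I , inverse S' U' U S U'U≈I S'S≈I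
    where
    inverse : ∀ {m} (A B B' A' : Mat m m) → (B ⊗ B') ≈M idM → (A ⊗ A') ≈M idM →
              ((A ⊗ B) ⊗ (B' ⊗ A')) ≈M idM
    inverse A B B' A' BB'≈I AA'≈I =
      ≈M-trans (≈M-sym (⊗-assoc (A ⊗ B) B' A')) (≈M-trans (⊗-cancel A A' BB'≈I) AA'≈I)

  record _∼_ {m k : ℕ} (A B : Mat m k) : Set where
    constructor mk∼
    field
      left  : Mat m m
      right : Mat k k
      left-unimodular  : Unimodular left
      right-unimodular : Unimodular right
      transforms       : ((left ⊗ A) ⊗ right) ≈M B

  ≈M⇒∼ : ∀ {m k} {A B : Mat m k} → A ≈M B → A ∼ B
  ≈M⇒∼ {A = A} A≈B =
    mk∼ idM idM Unimodular-idM Unimodular-idM (≈M-trans (⊗-identityʳ _) (≈M-trans (⊗-identityˡ A) A≈B))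

  ∼-trans : ∀ {m k} {A B C : Mat m k} → A ∼ B → B ∼ C → A ∼ C
  ∼-trans {A = A} (mk∼ S T uS uT SAT≈B) (mk∼ S₂ T₂ uS₂ uT₂ S₂BT₂≈C) =
    mk∼ (S₂ ⊗ S) (T ⊗ T₂) (Unimodular-⊗ uS uS₂) (Unimodular-⊗ uT₂ uT) $
    ≈M-trans (⊗-congʳ (T ⊗ T₂) (⊗-assoc S₂ S A)) $
    ≈M-trans (≈M-sym (⊗-assoc (S₂ ⊗ (S ⊗ A)) T T₂)) $
    ≈M-trans (⊗-congʳ T₂ (⊗-assoc S₂ (S ⊗ A) T)) $
    ≈M-trans (⊗-congʳ T₂ (⊗-congˡ S₂ SAT≈B)) S₂BT₂≈C

  ∼-⊗ˡ : ∀ {m k} (A : Mat m k) (S : Mat m m) → Unimodular S → A ∼ (S ⊗ A)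
  ∼-⊗ˡ A S uS = mk∼ S idM uS Unimodular-idM (⊗-identityʳ _)

  ∼-⊗ʳ : ∀ {m k} (A : Mat m k) (T : Mat k k) → Unimodular T → A ∼ (A ⊗ T)
  ∼-⊗ʳ A T uT = mk∼ idM T Unimodular-idM uT (⊗-congʳ _ (⊗-identityˡ A))

  _*ᵥ_ : ∀ {a b} → Mat a b → (Fin b → ℤ) → Fin a → ℤ
  (A *ᵥ z) i = Σℤ (λ l → A i l * z l)

  _ᵥ*_ : ∀ {a b} → (Fin a → ℤ) → Mat a b → Fin b → ℤ
  (x ᵥ* A) j = Σℤ (λ l → x l * A l j)

  column : ∀ {a} → (Fin a → ℤ) → Mat a 1
  column z l _ = z l

  row : ∀ {a} → (Fin a → ℤ) → Mat 1 a
  row x _ l = x l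

  *ᵥ-assoc : ∀ {a b c} (A : Mat a b) (B : Mat b c) z i → ((A ⊗ B) *ᵥ z) i ≡ (A *ᵥ (B *ᵥ z)) i
  *ᵥ-assoc A B z i = ⊗-assoc A B (column z) i zero

  ᵥ*-assoc : ∀ {a b c} x (A : Mat a b) (B : Mat b c) j → ((x ᵥ* A) ᵥ* B) j ≡ (x ᵥ* (A ⊗ B)) j
  ᵥ*-assoc x A B j = ⊗-assoc (row x) A B zero j

  *ᵥ-cong : ∀ {a b} {A A' : Mat a b} {z z' : Fin b → ℤ} → A ≈M A' → (∀ l → z l ≡ z' l) →
            ∀ i → (A *ᵥ z) i ≡ (A' *ᵥ z') i
  *ᵥ-cong A≈A' z≗z' i = Σℤ-cong (λ l → cong₂ _*_ (A≈A' i l) (z≗z' l))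

  ᵥ*-congʳ : ∀ {a b} (x : Fin a → ℤ) {A A' : Mat a b} → A ≈M A' → ∀ j → (x ᵥ* A) j ≡ (x ᵥ* A') j
  ᵥ*-congʳ x A≈A' j = Σℤ-cong (λ l → cong (x l *_) (A≈A' l j))

  *ᵥ-identityˡ : ∀ {a} (z : Fin a → ℤ) i → (idM *ᵥ z) i ≡ z i
  *ᵥ-identityˡ z i = ⊗-identityˡ (column z) i zero

  ᵥ*-identityʳ : ∀ {a} (x : Fin a → ℤ) j → (x ᵥ* idM) j ≡ x j
  ᵥ*-identityʳ x j = ⊗-identityʳ (row x) zero j

  unitRow : ∀ {a} → ℤ → Fin a → Fin a → ℤ
  unitRow y i l = y * δ i l

  unitRow-ᵥ* : ∀ {a b} y i (A : Mat a b) j → (unitRow y i ᵥ* A) j ≡ y * A i j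
  unitRow-ᵥ* y i A j =
    trans (Σℤ-cong (λ l → regroup y (δ i l) (A l j))) (Σℤ-δˡ i (λ l → y * A l j))
    where
    regroup : ∀ y d a → y * d * a ≡ d * (y * a)
    regroup = solve-∀

  *ᵥ-*ˡ : ∀ {a b} (A : Mat a b) (c : ℤ) z i → (A *ᵥ (λ l → c * z l)) i ≡ c * (A *ᵥ z) i
  *ᵥ-*ˡ A c z i = trans (Σℤ-cong (λ l → swap (A i l) c (z l))) (Σℤ-*ˡ c (λ l → A i l * z l))
    where
    swap : ∀ x y w → x * (y * w) ≡ y * (x * w)
    swap = solve-∀

  ∣-ᵥ* : ∀ {a b} {d : ℤ} {x : Fin a → ℤ} (A : Mat a b) → (∀ l → d ∣ℤ x l) → ∀ j → d ∣ℤ (x ᵥ* A) j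
  ∣-ᵥ* A d∣x j = ∣-Σℤ _ (λ l → ℤ∣.∣m⇒∣m*n (A l j) (d∣x l))

module ElementaryMatrices where

  open import Data.Integer using (_+_; _*_)
  open MatrixAlgebra

  transvection : ∀ {k} → (Fin k → ℤ) → (Fin k → ℤ) → Mat k k
  transvection a c i l = δ i l + a i * c l

  transvection-⊗ : ∀ {k n} (a c : Fin k → ℤ) (A : Mat k n) i j →
    (transvection a c ⊗ A) i j ≡ A i j + a i * (c ᵥ* A) j
  transvection-⊗ a c A i j = begin
    Σℤ (λ l → (δ i l + a i * c l) * A l j)
      ≡⟨ Σℤ-cong (λ l → ℤₚ.*-distribʳ-+ (A l j) (δ i l) (a i * c l)) ⟩
    Σℤ (λ l → δ i l * A l j + a i * c l * A l j)
      ≡⟨ Σℤ-+ (λ l → δ i l * A l j) (λ l → a i * c l * A l j) ⟩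
    Σℤ (λ l → δ i l * A l j) + Σℤ (λ l → a i * c l * A l j)
      ≡⟨ cong₂ _+_ (Σℤ-δˡ i (λ l → A l j))
                   (trans (Σℤ-cong (λ l → ℤₚ.*-assoc (a i) (c l) (A l j)))
                          (Σℤ-*ˡ (a i) (λ l → c l * A l j))) ⟩
    A i j + a i * (c ᵥ* A) j ∎
    where open ≡-Reasoning

  ⊗-transvection : ∀ {k n} (a c : Fin k → ℤ) (A : Mat n k) i j →
    (A ⊗ transvection a c) i j ≡ A i j + (A *ᵥ a) i * c j
  ⊗-transvection a c A i j = begin
    Σℤ (λ l → A i l * (δ l j + a l * c j))
      ≡⟨ Σℤ-cong (λ l → distrib (A i l) (δ l j) (a l) (c j)) ⟩
    Σℤ (λ l → A i l * δ l j + A i l * a l * c j)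
      ≡⟨ Σℤ-+ (λ l → A i l * δ l j) (λ l → A i l * a l * c j) ⟩
    Σℤ (λ l → A i l * δ l j) + Σℤ (λ l → A i l * a l * c j)
      ≡⟨ cong₂ _+_ (Σℤ-δʳ j (A i)) (Σℤ-*ʳ (c j) (λ l → A i l * a l)) ⟩
    A i j + (A *ᵥ a) i * c j ∎
    where
    open ≡-Reasoning
    distrib : ∀ x d y z → x * (d + y * z) ≡ x * d + x * y * z
    distrib = solve-∀

  transvection-inverse : ∀ {k} (a c : Fin k → ℤ) → Σℤ (λ l → c l * a l) ≡ 0ℤ →
    (transvection (λ l → - a l) c ⊗ transvection a c) ≈M idM
  transvection-inverse a c c·a≡0 i j = begin
    (transvection (λ l → - a l) c ⊗ transvection a c) i j
      ≡⟨ transvection-⊗ (λ l → - a l) c (transvection a c) i j ⟩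
    δ i j + a i * c j + - a i * (c ᵥ* transvection a c) j
      ≡⟨ cong (λ z → δ i j + a i * c j + - a i * z) c·T≡c ⟩
    δ i j + a i * c j + - a i * c j
      ≡⟨ cancel (δ i j) (a i) (c j) ⟩
    δ i j
      ≡⟨ sym (idM≡δ i j) ⟩
    idM i j ∎
    where
    open ≡-Reasoning
    cancel : ∀ x y z → x + y * z + - y * z ≡ x
    cancel = solve-∀
    c·T≡c : (c ᵥ* transvection a c) j ≡ c j
    c·T≡c = begin
      (c ᵥ* transvection a c) j   ≡⟨ ⊗-transvection a c (row c) zero j ⟩
      c j + Σℤ (λ l → c l * a l) * c j ≡⟨ cong (λ z → c j + z * c j) c·a≡0 ⟩
      c j + 0ℤ                    ≡⟨ ℤₚ.+-identityʳ (c j) ⟩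
      c j                         ∎

  transvection-unimodular : ∀ {k} (a c : Fin k → ℤ) → Σℤ (λ l → c l * a l) ≡ 0ℤ →
    Unimodular (transvection a c)
  transvection-unimodular a c c·a≡0 =
    transvection (λ l → - a l) c ,
    ≈M-trans (⊗-congʳ (transvection (λ l → - a l) c) a≈⁻⁻a)
             (transvection-inverse (λ l → - a l) c c·-a≡0) ,
    transvection-inverse a c c·a≡0
    where
    a≈⁻⁻a : transvection a c ≈M transvection (λ l → - - a l) c
    a≈⁻⁻a i l = cong (λ z → δ i l + z * c l) (sym (ℤₚ.neg-involutive (a i)))
    c·-a≡0 : Σℤ (λ l → c l * - a l) ≡ 0ℤ
    c·-a≡0 = begin
      Σℤ (λ l → c l * - a l)   ≡⟨ Σℤ-cong (λ l → sym (ℤₚ.neg-distribʳ-* (c l) (a l))) ⟩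
      Σℤ (λ l → - (c l * a l)) ≡⟨ Σℤ-neg (λ l → c l * a l) ⟩
      - Σℤ (λ l → c l * a l)   ≡⟨ cong -_ c·a≡0 ⟩
      0ℤ                       ∎
      where open ≡-Reasoning

  rowPermutation : ∀ {k} → (Fin k → Fin k) → Mat k k
  rowPermutation π i l = δ (π i) l

  columnPermutation : ∀ {k} → (Fin k → Fin k) → Mat k k
  columnPermutation π l j = δ l (π j)

  rowPermutation-⊗ : ∀ {k n} (π : Fin k → Fin k) (A : Mat k n) i j →
    (rowPermutation π ⊗ A) i j ≡ A (π i) j
  rowPermutation-⊗ π A i j = Σℤ-δˡ (π i) (λ l → A l j)

  ⊗-columnPermutation : ∀ {k n} (π : Fin k → Fin k) (A : Mat n k) i j →
    (A ⊗ columnPermutation π) i j ≡ A i (π j)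
  ⊗-columnPermutation π A i j = Σℤ-δʳ (π j) (A i)

  Involution : ∀ {k} → (Fin k → Fin k) → Set
  Involution π = ∀ i → π (π i) ≡ i

  rowPermutation-unimodular : ∀ {k} (π : Fin k → Fin k) → Involution π → Unimodular (rowPermutation π)
  rowPermutation-unimodular π π²≗id = rowPermutation π , P²≈I , P²≈I
    where
    P²≈I : (rowPermutation π ⊗ rowPermutation π) ≈M idM
    P²≈I i j = trans (rowPermutation-⊗ π (rowPermutation π) i j)
                     (trans (cong (λ z → δ z j) (π²≗id i)) (sym (idM≡δ i j)))

  columnPermutation-unimodular : ∀ {k} (π : Fin k → Fin k) → Involution π → Unimodular (columnPermutation π)
  columnPermutation-unimodular π π²≗id = columnPermutation π , Q²≈I , Q²≈I
    where
    Q²≈I : (columnPermutation π ⊗ columnPermutation π) ≈M idM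
    Q²≈I i j = trans (⊗-columnPermutation π (columnPermutation π) i j)
                     (trans (cong (δ i) (π²≗id j)) (sym (idM≡δ i j)))

  swap₀ : ∀ {k} → Fin (suc k) → Fin (suc k) → Fin (suc k)
  swap₀ r zero = r
  swap₀ r (suc i) with suc i Finₚ.≟ r
  ... | yes _ = zero
  ... | no  _ = suc i

  swap₀-involutive : ∀ {k} (r : Fin (suc k)) → Involution (swap₀ r)
  swap₀-involutive r zero = swap₀-r r
    where
    swap₀-r : ∀ {k} (r : Fin (suc k)) → swap₀ r r ≡ zero
    swap₀-r zero = refl
    swap₀-r (suc r) with suc r Finₚ.≟ suc r
    ... | yes _   = refl
    ... | no  r≢r = ⊥-elim (r≢r refl)
  swap₀-involutive r (suc i) with suc i Finₚ.≟ r
  ... | yes refl = refl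
  ... | no  i≢r with suc i Finₚ.≟ r
  ...   | yes i≡r = ⊥-elim (i≢r i≡r)
  ...   | no  _   = refl

  negateFirstRow : ∀ {k} → Mat (suc k) (suc k)
  negateFirstRow zero    l = - δ zero l
  negateFirstRow (suc i) l = δ (suc i) l

  negateFirstRow-⊗ : ∀ {k n} (A : Mat (suc k) n) j →
    (negateFirstRow ⊗ A) zero j ≡ - A zero j × (∀ i → (negateFirstRow ⊗ A) (suc i) j ≡ A (suc i) j)
  negateFirstRow-⊗ A j =
    trans (Σℤ-cong (λ l → sym (ℤₚ.neg-distribˡ-* (δ zero l) (A l j))))
          (trans (Σℤ-neg (λ l → δ zero l * A l j)) (cong -_ (Σℤ-δˡ zero (λ l → A l j)))) ,
    λ i → Σℤ-δˡ (suc i) (λ l → A l j)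

  negateFirstRow-unimodular : ∀ {k} → Unimodular (negateFirstRow {k})
  negateFirstRow-unimodular = negateFirstRow , N²≈I , N²≈I
    where
    N²≈I : (negateFirstRow ⊗ negateFirstRow) ≈M idM
    N²≈I zero j    = trans (proj₁ (negateFirstRow-⊗ negateFirstRow j))
                           (trans (ℤₚ.neg-involutive (δ zero j)) (sym (idM≡δ zero j)))
    N²≈I (suc i) j = trans (proj₂ (negateFirstRow-⊗ negateFirstRow j) i) (sym (idM≡δ (suc i) j))

module DiagonalForms where

  open import Data.Integer using (_+_; _*_)
  open MatrixAlgebra

  _⊕_ : ∀ {m k} → ℤ → Mat m k → Mat (suc m) (suc k)
  (a ⊕ A) zero    zero    = a
  (a ⊕ A) zero    (suc j) = 0ℤ
  (a ⊕ A) (suc i) zero    = 0ℤ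
  (a ⊕ A) (suc i) (suc j) = A i j

  ⊕-⊗ : ∀ {m k n} (a b : ℤ) (A : Mat m k) (B : Mat k n) → ((a ⊕ A) ⊗ (b ⊕ B)) ≈M ((a * b) ⊕ (A ⊗ B))
  ⊕-⊗ {k = k} a b A B zero zero = trans (cong (λ z → a * b + z) (Σℤ-zero {k} (λ _ → 0ℤ) (λ _ → refl)))
                                         (ℤₚ.+-identityʳ (a * b))
  ⊕-⊗ {k = k} a b A B zero (suc j) = cong₂ _+_ (ℤₚ.*-zeroʳ a) (Σℤ-zero {k} (λ _ → 0ℤ) (λ _ → refl))
  ⊕-⊗ a b A B (suc i) zero = Σℤ-zero (λ l → (a ⊕ A) (suc i) l * (b ⊕ B) l zero)
                                     (λ { zero → refl ; (suc l) → ℤₚ.*-zeroʳ (A i l) })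
  ⊕-⊗ a b A B (suc i) (suc j) = ℤₚ.+-identityˡ _

  ⊕-cong : ∀ {m k} {a b : ℤ} {A B : Mat m k} → a ≡ b → A ≈M B → (a ⊕ A) ≈M (b ⊕ B)
  ⊕-cong a≡b A≈B zero    zero    = a≡b
  ⊕-cong a≡b A≈B zero    (suc j) = refl
  ⊕-cong a≡b A≈B (suc i) zero    = refl
  ⊕-cong a≡b A≈B (suc i) (suc j) = A≈B i j

  1⊕idM : ∀ {m} → (1ℤ ⊕ idM {m}) ≈M idM
  1⊕idM i j = trans (⊕δ i j) (sym (idM≡δ i j))
    where
    ⊕δ : ∀ {m} (i j : Fin (suc m)) → (1ℤ ⊕ idM) i j ≡ δ i j
    ⊕δ zero    zero    = refl
    ⊕δ zero    (suc j) = refl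
    ⊕δ (suc i) zero    = refl
    ⊕δ (suc i) (suc j) = idM≡δ i j

  1⊕-unimodular : ∀ {m} {S : Mat m m} → Unimodular S → Unimodular (1ℤ ⊕ S)
  1⊕-unimodular {S = S} (S' , SS'≈I , S'S≈I) = 1ℤ ⊕ S' ,
    ≈M-trans (⊕-⊗ 1ℤ 1ℤ S S') (≈M-trans (⊕-cong refl SS'≈I) 1⊕idM) ,
    ≈M-trans (⊕-⊗ 1ℤ 1ℤ S' S) (≈M-trans (⊕-cong refl S'S≈I) 1⊕idM)

  ⊕-∼ : ∀ {m k} (a : ℤ) {A B : Mat m k} → A ∼ B → (a ⊕ A) ∼ (a ⊕ B)
  ⊕-∼ a {A} (mk∼ S T uS uT SAT≈B) = mk∼ (1ℤ ⊕ S) (1ℤ ⊕ T) (1⊕-unimodular uS) (1⊕-unimodular uT) $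
    ≈M-trans (⊗-congʳ (1ℤ ⊕ T) (⊕-⊗ 1ℤ a S A)) $
    ≈M-trans (⊕-⊗ (1ℤ * a) 1ℤ (S ⊗ A) T) $
    ⊕-cong (trans (ℤₚ.*-identityʳ _) (ℤₚ.*-identityˡ a)) SAT≈B

  module _ {m k : ℕ} (D : SNFData m k) where
    open SNFData D

    snfMat-diagonal : ∀ i j → toℕ i ≡ toℕ j → (i<ℓ : toℕ i < ℓ) → snfMat D i j ≡ + e (fromℕ< i<ℓ)
    snfMat-diagonal i j i≡j i<ℓ with toℕ i ℕ.≟ toℕ j | toℕ i ℕ.<? ℓ
    ... | yes _   | yes i<ℓ′ = cong (λ z → + e z) (Finₚ.fromℕ<-cong _ _ refl i<ℓ′ i<ℓ)
    ... | yes _   | no  i≮ℓ  = ⊥-elim (i≮ℓ i<ℓ)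
    ... | no  i≢j | _        = ⊥-elim (i≢j i≡j)

    snfMat-offDiagonal : ∀ i j → toℕ i ≢ toℕ j → snfMat D i j ≡ 0ℤ
    snfMat-offDiagonal i j i≢j with toℕ i ℕ.≟ toℕ j | toℕ i ℕ.<? ℓ
    ... | yes i≡j | _ = ⊥-elim (i≢j i≡j)
    ... | no  _   | _ = refl

    snfMat-beyondRank : ∀ i j → ¬ toℕ i < ℓ → snfMat D i j ≡ 0ℤ
    snfMat-beyondRank i j i≮ℓ with toℕ i ℕ.≟ toℕ j | toℕ i ℕ.<? ℓ
    ... | yes _ | yes i<ℓ = ⊥-elim (i≮ℓ i<ℓ)
    ... | yes _ | no  _   = refl
    ... | no  _ | _       = refl

  zeroSNF : ∀ {m k} → SNFData m k
  zeroSNF = record { ℓ = 0 ; ℓ≤m = z≤n ; ℓ≤k = z≤n ; e = λ () ; e-pos = λ () ; chain = λ () }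

  snfMat-zeroSNF : ∀ {m k} (i : Fin m) (j : Fin k) → snfMat zeroSNF i j ≡ 0ℤ
  snfMat-zeroSNF i j = snfMat-beyondRank zeroSNF i j (λ ())

  consSNF : ∀ {m k} (d : ℕ) → 0 < d → (D : SNFData m k) → (∀ i → d ∣ SNFData.e D i) → SNFData (suc m) (suc k)
  consSNF d d>0 D d∣e = record
    { ℓ = suc ℓ ; ℓ≤m = s≤s ℓ≤m ; ℓ≤k = s≤s ℓ≤k ; e = e′ ; e-pos = e′-pos ; chain = e′-chain }
    where
    open SNFData D
    e′ : Fin (suc ℓ) → ℕ
    e′ zero    = d
    e′ (suc i) = e i
    e′-pos : ∀ i → 0 < e′ i
    e′-pos zero    = d>0
    e′-pos (suc i) = e-pos i
    e′-chain : ∀ i j → toℕ i ≤ toℕ j → e′ i ∣ e′ j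
    e′-chain zero    zero    _         = ∣-refl
    e′-chain zero    (suc j) _         = d∣e j
    e′-chain (suc i) (suc j) (s≤s i≤j) = chain i j i≤j

  snfMat-consSNF : ∀ {m k} (d : ℕ) (d>0 : 0 < d) (D : SNFData m k) (d∣e : ∀ i → d ∣ SNFData.e D i) →
    snfMat (consSNF d d>0 D d∣e) ≈M ((+ d) ⊕ snfMat D)
  snfMat-consSNF d d>0 D d∣e = entries
    where
    D′ = consSNF d d>0 D d∣e
    entries : snfMat D′ ≈M ((+ d) ⊕ snfMat D)
    entries zero    zero    = snfMat-diagonal D′ zero zero refl (s≤s z≤n)
    entries zero    (suc j) = snfMat-offDiagonal D′ zero (suc j) (λ ())
    entries (suc i) zero    = snfMat-offDiagonal D′ (suc i) zero (λ ())
    entries (suc i) (suc j) = inner (toℕ i ℕ.≟ toℕ j) (toℕ i ℕ.<? SNFData.ℓ D)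
      where
      inner : Dec (toℕ i ≡ toℕ j) → Dec (toℕ i < SNFData.ℓ D) → snfMat D′ (suc i) (suc j) ≡ snfMat D i j
      inner (no i≢j) _ = trans (snfMat-offDiagonal D′ (suc i) (suc j) (i≢j ∘ ℕₚ.suc-injective))
                               (sym (snfMat-offDiagonal D i j i≢j))
      inner (yes i≡j) (yes i<ℓ) = trans (snfMat-diagonal D′ (suc i) (suc j) (cong suc i≡j) (s≤s i<ℓ))
                                        (sym (snfMat-diagonal D i j i≡j i<ℓ))
      inner (yes _) (no i≮ℓ) = trans (snfMat-beyondRank D′ (suc i) (suc j) (λ { (s≤s i<ℓ) → i≮ℓ i<ℓ }))
                                     (sym (snfMat-beyondRank D i j i≮ℓ))

  padTo : ∀ {ℓ n} {X : Set} → X → (Fin ℓ → X) → Fin n → X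
  padTo {ℓ} x f κ with toℕ κ ℕ.<? ℓ
  ... | yes κ<ℓ = f (fromℕ< κ<ℓ)
  ... | no  _   = x

  padTo-inject≤ : ∀ {ℓ n} {X : Set} (x : X) (f : Fin ℓ → X) (ℓ≤n : ℓ ≤ n) i → padTo x f (inject≤ i ℓ≤n) ≡ f i
  padTo-inject≤ {ℓ} x f ℓ≤n i with toℕ (inject≤ i ℓ≤n) ℕ.<? ℓ
  ... | yes i<ℓ = cong f (Finₚ.toℕ-injective (trans (Finₚ.toℕ-fromℕ< i<ℓ) (Finₚ.toℕ-inject≤ i ℓ≤n)))
  ... | no  i≮ℓ = ⊥-elim (i≮ℓ (subst (_< ℓ) (sym (Finₚ.toℕ-inject≤ i ℓ≤n)) (Finₚ.toℕ<n i)))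

  padTo-beyond : ∀ {ℓ n} {X : Set} (x : X) (f : Fin ℓ → X) (κ : Fin n) → ¬ toℕ κ < ℓ → padTo x f κ ≡ x
  padTo-beyond {ℓ} x f κ κ≮ℓ with toℕ κ ℕ.<? ℓ
  ... | yes κ<ℓ = ⊥-elim (κ≮ℓ κ<ℓ)
  ... | no  _   = refl

  inject≤-or-beyond : ∀ {ℓ n} (ℓ≤n : ℓ ≤ n) (ρ : Fin n) → (∃ λ (i : Fin ℓ) → inject≤ i ℓ≤n ≡ ρ) ⊎ ¬ toℕ ρ < ℓ
  inject≤-or-beyond {ℓ} ℓ≤n ρ with toℕ ρ ℕ.<? ℓ
  ... | yes ρ<ℓ = inj₁ (fromℕ< ρ<ℓ , Finₚ.toℕ-injective (trans (Finₚ.toℕ-inject≤ _ ℓ≤n) (Finₚ.toℕ-fromℕ< ρ<ℓ)))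
  ... | no  ρ≮ℓ = inj₂ ρ≮ℓ

  module _ {m k : ℕ} (D : SNFData m k) where
    open SNFData D

    ιₘ : Fin ℓ → Fin m
    ιₘ i = inject≤ i ℓ≤m

    ιₖ : Fin ℓ → Fin k
    ιₖ i = inject≤ i ℓ≤k

    toℕ-ι : ∀ i → toℕ (ιₘ i) ≡ toℕ (ιₖ i)
    toℕ-ι i = trans (Finₚ.toℕ-inject≤ i ℓ≤m) (sym (Finₚ.toℕ-inject≤ i ℓ≤k))

    snfMat-ι : ∀ i → snfMat D (ιₘ i) (ιₖ i) ≡ + e i
    snfMat-ι i = trans (snfMat-diagonal D (ιₘ i) (ιₖ i) (toℕ-ι i) ιₘi<ℓ)
                       (cong (λ z → + e z) (Finₚ.toℕ-injective (trans (Finₚ.toℕ-fromℕ< ιₘi<ℓ) (Finₚ.toℕ-inject≤ i ℓ≤m))))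
      where
      ιₘi<ℓ : toℕ (ιₘ i) < ℓ
      ιₘi<ℓ = subst (_< ℓ) (sym (Finₚ.toℕ-inject≤ i ℓ≤m)) (Finₚ.toℕ<n i)

    snfMat-columnBeyondRank : ∀ ρ κ → ¬ toℕ κ < ℓ → snfMat D ρ κ ≡ 0ℤ
    snfMat-columnBeyondRank ρ κ κ≮ℓ = byDiagonality (toℕ ρ ℕ.≟ toℕ κ)
      where
      byDiagonality : Dec (toℕ ρ ≡ toℕ κ) → snfMat D ρ κ ≡ 0ℤ
      byDiagonality (yes ρ≡κ) = snfMat-beyondRank D ρ κ (κ≮ℓ ∘ subst (_< ℓ) ρ≡κ)
      byDiagonality (no  ρ≢κ) = snfMat-offDiagonal D ρ κ ρ≢κ

    snfMat-*ᵥ-ι : ∀ v i → (snfMat D *ᵥ v) (ιₘ i) ≡ + e i * v (ιₖ i)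
    snfMat-*ᵥ-ι v i = trans (Σℤ-single (ιₖ i) _ off) (cong (_* v (ιₖ i)) (snfMat-ι i))
      where
      off : ∀ l → l ≢ ιₖ i → snfMat D (ιₘ i) l * v l ≡ 0ℤ
      off l l≢ι = trans (cong (_* v l) (snfMat-offDiagonal D (ιₘ i) l
                          (λ ι≡l → l≢ι (Finₚ.toℕ-injective (sym (trans (sym (toℕ-ι i)) ι≡l))))))
                        (ℤₚ.*-zeroˡ (v l))

    snfMat-*ᵥ-beyondRank : ∀ v ρ → ¬ toℕ ρ < ℓ → (snfMat D *ᵥ v) ρ ≡ 0ℤ
    snfMat-*ᵥ-beyondRank v ρ ρ≮ℓ =
      Σℤ-zero _ (λ l → trans (cong (_* v l) (snfMat-beyondRank D ρ l ρ≮ℓ)) (ℤₚ.*-zeroˡ (v l)))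

    ᵥ*-snfMat-ι : ∀ u i → (u ᵥ* snfMat D) (ιₖ i) ≡ u (ιₘ i) * + e i
    ᵥ*-snfMat-ι u i = trans (Σℤ-single (ιₘ i) _ off) (cong (u (ιₘ i) *_) (snfMat-ι i))
      where
      off : ∀ l → l ≢ ιₘ i → u l * snfMat D l (ιₖ i) ≡ 0ℤ
      off l l≢ι = trans (cong (u l *_) (snfMat-offDiagonal D l (ιₖ i)
                          (λ l≡ι → l≢ι (Finₚ.toℕ-injective (trans l≡ι (sym (toℕ-ι i)))))))
                        (ℤₚ.*-zeroʳ (u l))

    ᵥ*-snfMat-beyondRank : ∀ u κ → ¬ toℕ κ < ℓ → (u ᵥ* snfMat D) κ ≡ 0ℤ
    ᵥ*-snfMat-beyondRank u κ κ≮ℓ =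
      Σℤ-zero _ (λ l → trans (cong (u l *_) (snfMat-columnBeyondRank l κ κ≮ℓ)) (ℤₚ.*-zeroʳ (u l)))

    diagonal : Fin m → ℕ
    diagonal = padTo 0 e

    diagonal-ι : ∀ i → diagonal (ιₘ i) ≡ e i
    diagonal-ι = padTo-inject≤ 0 e ℓ≤m

    diagonal-beyondRank : ∀ ρ → ¬ toℕ ρ < ℓ → diagonal ρ ≡ 0
    diagonal-beyondRank = padTo-beyond 0 e

module SmithNormalFormExistence where

  open import Data.Integer using (_+_; _*_)
  import Data.Integer.DivMod as ℤ÷
  open MatrixAlgebra
  open ElementaryMatrices
  open DiagonalForms

  nonzeroRemainder : (a b : ℤ) → a ≢ 0ℤ → ¬ a ∣ℤ b →
    ∃[ q ] ∃[ r ] (b + - q * a ≡ + r) × 0 < r × r < ∣ a ∣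
  nonzeroRemainder a b a≢0 a∤b = q , r , b-qa≡r , ℕₚ.n≢0⇒n>0 r≢0 , ℤ÷.n%d<d b a
    where
    instance _ = ℤ.≢-nonZero a≢0
    q = b ℤ./ a
    r = b ℤ.% a
    b≡r+qa : b ≡ + r + q * a
    b≡r+qa = ℤ÷.a≡a%n+[a/n]*n b a
    cancel : ∀ x y z → x + y * z + - y * z ≡ x
    cancel = solve-∀
    b-qa≡r : b + - q * a ≡ + r
    b-qa≡r = trans (cong (λ z → z + - q * a) b≡r+qa) (cancel (+ r) q a)
    r≢0 : r ≢ 0
    r≢0 r≡0 = a∤b (ℤ∣.divides q (trans b≡r+qa (trans (cong (λ z → + z + q * a) r≡0) (ℤₚ.+-identityˡ _))))

  SmallerCorner : ∀ {m k} → Mat (suc m) (suc k) → Set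
  SmallerCorner A = ∃ λ A′ → A ∼ A′ × 0 < ∣ A′ zero zero ∣ × ∣ A′ zero zero ∣ < ∣ A zero zero ∣

  smallerCorner : ∀ {m k} {A A′ : Mat (suc m) (suc k)} {r} →
    A ∼ A′ → A′ zero zero ≡ + r → 0 < r → r < ∣ A zero zero ∣ → SmallerCorner A
  smallerCorner {A′ = A′} A∼A′ A′₀₀≡r r>0 r<a =
    A′ , A∼A′ , subst (0 <_) (sym ∣A′₀₀∣≡r) r>0 , subst (_< _) (sym ∣A′₀₀∣≡r) r<a
    where ∣A′₀₀∣≡r = cong ∣_∣ A′₀₀≡r

  e₀ : ∀ {k} → Fin (suc k) → ℤ
  e₀ = δ zero

  addFirstRow : ∀ {m n} (t : Fin (suc m) → ℤ) (A : Mat (suc m) n) i j →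
    (transvection t e₀ ⊗ A) i j ≡ A i j + t i * A zero j
  addFirstRow t A i j =
    trans (transvection-⊗ t e₀ A i j) (cong (λ z → A i j + t i * z) (Σℤ-δˡ zero (λ l → A l j)))

  addFirstColumn : ∀ {m n} (u : Fin (suc n) → ℤ) (A : Mat m (suc n)) i j →
    (A ⊗ transvection e₀ u) i j ≡ A i j + A i zero * u j
  addFirstColumn u A i j = trans (⊗-transvection e₀ u A i j) (cong (λ z → A i j + z * u j) A·e₀≡A₀)
    where
    A·e₀≡A₀ : Σℤ (λ l → A i l * e₀ l) ≡ A i zero
    A·e₀≡A₀ = trans (Σℤ-cong (λ l → cong (A i l *_) (δ-sym zero l))) (Σℤ-δʳ zero (A i))

  addFirstRow-unimodular : ∀ {m} (t : Fin (suc m) → ℤ) → t zero ≡ 0ℤ → Unimodular (transvection t e₀)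
  addFirstRow-unimodular t t₀≡0 = transvection-unimodular t e₀ (trans (Σℤ-δˡ zero t) t₀≡0)

  addFirstColumn-unimodular : ∀ {n} (u : Fin (suc n) → ℤ) → u zero ≡ 0ℤ → Unimodular (transvection e₀ u)
  addFirstColumn-unimodular u u₀≡0 = transvection-unimodular e₀ u (trans (Σℤ-δʳ zero u) u₀≡0)

  reduce-column : ∀ {m k} (A : Mat (suc m) (suc k)) → A zero zero ≢ 0ℤ → (i : Fin m) →
    ¬ A zero zero ∣ℤ A (suc i) zero → SmallerCorner A
  reduce-column A a≢0 i a∤b with nonzeroRemainder (A zero zero) (A (suc i) zero) a≢0 a∤b
  ... | q , r , b-qa≡r , r>0 , r<a = smallerCorner A∼A₂ A₂₀₀≡r r>0 r<a
    where
    t = unitRow (- q) (suc i)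
    A₁ = transvection t e₀ ⊗ A
    A₂ = rowPermutation (swap₀ (suc i)) ⊗ A₁
    A∼A₂ : A ∼ A₂
    A∼A₂ = ∼-trans (∼-⊗ˡ A (transvection t e₀) (addFirstRow-unimodular t (ℤₚ.*-zeroʳ (- q))))
                   (∼-⊗ˡ A₁ (rowPermutation (swap₀ (suc i)))
                      (rowPermutation-unimodular (swap₀ (suc i)) (swap₀-involutive (suc i))))
    shift-by : ∀ b q a → b + - q * 1ℤ * a ≡ b + - q * a
    shift-by = solve-∀
    A₂₀₀≡r : A₂ zero zero ≡ + r
    A₂₀₀≡r = begin
      A₂ zero zero                             ≡⟨ rowPermutation-⊗ (swap₀ (suc i)) A₁ zero zero ⟩
      A₁ (suc i) zero                          ≡⟨ addFirstRow t A (suc i) zero ⟩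
      A (suc i) zero + - q * δ i i * A zero zero ≡⟨ cong (λ x → A (suc i) zero + - q * x * A zero zero) (δ-refl i) ⟩
      A (suc i) zero + - q * 1ℤ * A zero zero  ≡⟨ shift-by (A (suc i) zero) q (A zero zero) ⟩
      A (suc i) zero + - q * A zero zero       ≡⟨ b-qa≡r ⟩
      + r                                      ∎
      where open ≡-Reasoning

  reduce-row : ∀ {m k} (A : Mat (suc m) (suc k)) → A zero zero ≢ 0ℤ → (j : Fin k) →
    ¬ A zero zero ∣ℤ A zero (suc j) → SmallerCorner A
  reduce-row A a≢0 j a∤b with nonzeroRemainder (A zero zero) (A zero (suc j)) a≢0 a∤b
  ... | q , r , b-qa≡r , r>0 , r<a = smallerCorner A∼A₂ A₂₀₀≡r r>0 r<a
    where
    u = unitRow (- q) (suc j)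
    A₁ = A ⊗ transvection e₀ u
    A₂ = A₁ ⊗ columnPermutation (swap₀ (suc j))
    A∼A₂ : A ∼ A₂
    A∼A₂ = ∼-trans (∼-⊗ʳ A (transvection e₀ u) (addFirstColumn-unimodular u (ℤₚ.*-zeroʳ (- q))))
                   (∼-⊗ʳ A₁ (columnPermutation (swap₀ (suc j)))
                      (columnPermutation-unimodular (swap₀ (suc j)) (swap₀-involutive (suc j))))
    shift-by : ∀ b q a → b + a * (- q * 1ℤ) ≡ b + - q * a
    shift-by = solve-∀
    A₂₀₀≡r : A₂ zero zero ≡ + r
    A₂₀₀≡r = begin
      A₂ zero zero                               ≡⟨ ⊗-columnPermutation (swap₀ (suc j)) A₁ zero zero ⟩
      A₁ zero (suc j)                            ≡⟨ addFirstColumn u A zero (suc j) ⟩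
      A zero (suc j) + A zero zero * (- q * δ j j) ≡⟨ cong (λ x → A zero (suc j) + A zero zero * (- q * x)) (δ-refl j) ⟩
      A zero (suc j) + A zero zero * (- q * 1ℤ)  ≡⟨ shift-by (A zero (suc j)) q (A zero zero) ⟩
      A zero (suc j) + - q * A zero zero         ≡⟨ b-qa≡r ⟩
      + r                                        ∎
      where open ≡-Reasoning

  clear-corner : ∀ {m k} (A : Mat (suc m) (suc k)) →
    (∀ i → A zero zero ∣ℤ A (suc i) zero) → (∀ j → A zero zero ∣ℤ A zero (suc j)) →
    ∃ λ B → A ∼ (A zero zero ⊕ B)
  clear-corner A a∣col a∣row = (λ i j → A₂ (suc i) (suc j)) , ∼-trans A∼A₂ (≈M⇒∼ A₂≈a⊕B)
    where
    a = A zero zero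
    t : Fin (suc _) → ℤ
    t zero    = 0ℤ
    t (suc i) = - ℤ∣.quotient (a∣col i)
    u : Fin (suc _) → ℤ
    u zero    = 0ℤ
    u (suc j) = - ℤ∣.quotient (a∣row j)
    A₁ = transvection t e₀ ⊗ A
    A₂ = A₁ ⊗ transvection e₀ u
    A∼A₂ : A ∼ A₂
    A∼A₂ = ∼-trans (∼-⊗ˡ A (transvection t e₀) (addFirstRow-unimodular t refl))
                   (∼-⊗ʳ A₁ (transvection e₀ u) (addFirstColumn-unimodular u refl))
    A₂-entry : ∀ i j → A₂ i j ≡ (A i j + t i * A zero j) + (A i zero + t i * a) * u j
    A₂-entry i j = trans (addFirstColumn u A₁ i j)
                         (cong₂ (λ x y → x + y * u j) (addFirstRow t A i j) (addFirstRow t A i zero))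
    kill-corner : ∀ x → x + 0ℤ * x + (x + 0ℤ * x) * 0ℤ ≡ x
    kill-corner = solve-∀
    kill-row : ∀ q a → q * a + 0ℤ * (q * a) + (a + 0ℤ * a) * - q ≡ 0ℤ
    kill-row = solve-∀
    kill-column : ∀ q a → q * a + - q * a + (q * a + - q * a) * 0ℤ ≡ 0ℤ
    kill-column = solve-∀
    A₂≈a⊕B : A₂ ≈M (a ⊕ (λ i j → A₂ (suc i) (suc j)))
    A₂≈a⊕B zero    zero    = trans (A₂-entry zero zero) (kill-corner a)
    A₂≈a⊕B zero    (suc j) = trans (A₂-entry zero (suc j))
      (subst (λ b → b + 0ℤ * b + (a + 0ℤ * a) * - ℤ∣.quotient (a∣row j) ≡ 0ℤ)
             (sym (ℤ∣._∣_.equality (a∣row j))) (kill-row (ℤ∣.quotient (a∣row j)) a))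
    A₂≈a⊕B (suc i) zero    = trans (A₂-entry (suc i) zero)
      (subst (λ b → b + - ℤ∣.quotient (a∣col i) * a + (b + - ℤ∣.quotient (a∣col i) * a) * 0ℤ ≡ 0ℤ)
             (sym (ℤ∣._∣_.equality (a∣col i))) (kill-column (ℤ∣.quotient (a∣col i)) a))
    A₂≈a⊕B (suc i) (suc j) = refl

  SplitsOffCorner : ∀ {m k} → Mat (suc m) (suc k) → Set
  SplitsOffCorner {m} {k} A =
    ∃[ d ] ∃ λ (B : Mat m k) → 0 < d × (∀ i j → + d ∣ℤ B i j) × A ∼ ((+ d) ⊕ B)

  splitsOffCorner-∼ : ∀ {m k} {A A′ : Mat (suc m) (suc k)} → A ∼ A′ → SplitsOffCorner A′ → SplitsOffCorner A
  splitsOffCorner-∼ A∼A′ (d , B , d>0 , d∣B , A′∼d⊕B) = d , B , d>0 , d∣B , ∼-trans A∼A′ A′∼d⊕B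

  SplitsOffBelow : ℕ → ℕ → ℕ → Set
  SplitsOffBelow m k f =
    ∀ (A : Mat (suc m) (suc k)) → A zero zero ≢ 0ℤ → ∣ A zero zero ∣ ≤ f → SplitsOffCorner A

  viaSmallerCorner : ∀ {m k f} → SplitsOffBelow m k f →
    (A : Mat (suc m) (suc k)) → ∣ A zero zero ∣ ≤ suc f → SmallerCorner A → SplitsOffCorner A
  viaSmallerCorner split A a≤1+f (A′ , A∼A′ , a′>0 , a′<a) = splitsOffCorner-∼ A∼A′
    (split A′ (λ a′≡0 → ℕₚ.<-irrefl (sym (cong ∣_∣ a′≡0)) a′>0) (ℕₚ.≤-pred (ℕₚ.≤-trans a′<a a≤1+f)))

  negate-corner : ∀ {m k} (a : ℤ) (B : Mat m k) → (a ⊕ B) ∼ ((- a) ⊕ B)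
  negate-corner a B = ∼-trans (∼-⊗ˡ (a ⊕ B) negateFirstRow negateFirstRow-unimodular) (≈M⇒∼ N⊗a⊕B)
    where
    N⊗a⊕B : (negateFirstRow ⊗ (a ⊕ B)) ≈M ((- a) ⊕ B)
    N⊗a⊕B zero    zero    = proj₁ (negateFirstRow-⊗ (a ⊕ B) zero)
    N⊗a⊕B zero    (suc j) = proj₁ (negateFirstRow-⊗ (a ⊕ B) (suc j))
    N⊗a⊕B (suc i) zero    = proj₂ (negateFirstRow-⊗ (a ⊕ B) zero) i
    N⊗a⊕B (suc i) (suc j) = proj₂ (negateFirstRow-⊗ (a ⊕ B) (suc j)) i

  ∣∣-corner : ∀ {m k} (a : ℤ) (B : Mat m k) → (a ⊕ B) ∼ ((+ ∣ a ∣) ⊕ B)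
  ∣∣-corner (+ n)      B = ≈M⇒∼ ≈M-refl
  ∣∣-corner ℤ.-[1+ n ] B = negate-corner ℤ.-[1+ n ] B

  split-cleared : ∀ {m k f} → SplitsOffBelow m k f →
    (a : ℤ) (B : Mat m k) → a ≢ 0ℤ → ∣ a ∣ ≤ suc f → SplitsOffCorner (a ⊕ B)
  split-cleared {f = f} split a B a≢0 a≤1+f with all-or-counterexample₂ (λ i j → a ℤ∣.∣? B i j)
  ... | inj₁ a∣B =
    ∣ a ∣ , B , ℕₚ.n≢0⇒n>0 (a≢0 ∘ ℤₚ.∣i∣≡0⇒i≡0) , (λ i j → ℤ∣.∣-trans ℤ∣.∣m∣∣m (a∣B i j)) , ∣∣-corner a B
  ... | inj₂ (i , j , a∤Bij) = splitsOffCorner-∼ (∼-⊗ˡ (a ⊕ B) R R-unimodular)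
    (viaSmallerCorner split A₃ (subst (λ z → ∣ z ∣ ≤ suc f) (sym A₃₀₀≡a) a≤1+f)
      (reduce-row A₃ (a≢0 ∘ trans (sym A₃₀₀≡a)) j (a∤Bij ∘ subst₂ _∣ℤ_ A₃₀₀≡a A₃₀ⱼ≡Bij)))
    where
    -- adding row i + 1 to row 0 keeps the corner and brings B i j into row 0
    R = transvection e₀ (δ (suc i))
    R-unimodular : Unimodular R
    R-unimodular = transvection-unimodular e₀ (δ (suc i)) (Σℤ-δˡ (suc i) e₀)
    A₃ = R ⊗ (a ⊕ B)
    A₃-row₀ : ∀ j → A₃ zero j ≡ (a ⊕ B) zero j + 1ℤ * (a ⊕ B) (suc i) j
    A₃-row₀ j = trans (transvection-⊗ e₀ (δ (suc i)) (a ⊕ B) zero j)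
                      (cong (λ z → (a ⊕ B) zero j + 1ℤ * z) (Σℤ-δˡ (suc i) (λ l → (a ⊕ B) l j)))
    A₃₀₀≡a : A₃ zero zero ≡ a
    A₃₀₀≡a = trans (A₃-row₀ zero) (ℤₚ.+-identityʳ a)
    A₃₀ⱼ≡Bij : A₃ zero (suc j) ≡ B i j
    A₃₀ⱼ≡Bij = trans (A₃-row₀ (suc j)) (trans (ℤₚ.+-identityˡ _) (ℤₚ.*-identityˡ (B i j)))

  splitsOffBelow : ∀ {m k} f → SplitsOffBelow m k f
  splitsOffBelow zero A a≢0 a≤0 = ⊥-elim (a≢0 (ℤₚ.∣i∣≡0⇒i≡0 (ℕₚ.n≤0⇒n≡0 a≤0)))
  splitsOffBelow (suc f) A a≢0 a≤1+f with all-or-counterexample (λ i → A zero zero ℤ∣.∣? A (suc i) zero)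
  ... | inj₂ (i , a∤) = viaSmallerCorner (splitsOffBelow f) A a≤1+f (reduce-column A a≢0 i a∤)
  ... | inj₁ a∣col with all-or-counterexample (λ j → A zero zero ℤ∣.∣? A zero (suc j))
  ...   | inj₂ (j , a∤) = viaSmallerCorner (splitsOffBelow f) A a≤1+f (reduce-row A a≢0 j a∤)
  ...   | inj₁ a∣row =
    let B , A∼a⊕B = clear-corner A a∣col a∣row
    in splitsOffCorner-∼ A∼a⊕B (split-cleared (splitsOffBelow f) (A zero zero) B a≢0 a≤1+f)

  ∣-⊗ˡ : ∀ {m k n} {d : ℤ} (S : Mat m k) {B : Mat k n} → (∀ i j → d ∣ℤ B i j) → ∀ i j → d ∣ℤ (S ⊗ B) i j
  ∣-⊗ˡ S {B} d∣B i j = ∣-Σℤ (λ l → S i l * B l j) (λ l → ℤ∣.∣n⇒∣m*n (S i l) (d∣B l j))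

  ∣-⊗ʳ : ∀ {m k n} {d : ℤ} {B : Mat m k} (T : Mat k n) → (∀ i j → d ∣ℤ B i j) → ∀ i j → d ∣ℤ (B ⊗ T) i j
  ∣-⊗ʳ T d∣B i j = ∣-ᵥ* T (d∣B i) j

  ∣-elementaryDivisors : ∀ {m k} {d : ℕ} {B : Mat m k} {D : SNFData m k} →
    (∀ i j → + d ∣ℤ B i j) → B ∼ snfMat D → ∀ i → d ∣ SNFData.e D i
  ∣-elementaryDivisors {d = d} {D = D} d∣B (mk∼ S T _ _ SBT≈D) i = ℤ∣.∣⇒∣ᵤ
    (subst (+ d ∣ℤ_) (trans (SBT≈D (ιₘ D i) (ιₖ D i)) (snfMat-ι D i)) (∣-⊗ʳ T (∣-⊗ˡ S d∣B) (ιₘ D i) (ιₖ D i)))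

  smithNormalForm : ∀ {m k} (A : Mat m k) → ∃ λ D → A ∼ snfMat D
  smithNormalForm {zero}          A = zeroSNF , ≈M⇒∼ (λ ())
  smithNormalForm {suc m} {zero}  A = zeroSNF , ≈M⇒∼ (λ i ())
  smithNormalForm {suc m} {suc k} A with all-or-counterexample₂ (λ i j → A i j ℤ.≟ 0ℤ)
  ... | inj₁ A≈0 = zeroSNF , ≈M⇒∼ (λ i j → trans (A≈0 i j) (sym (snfMat-zeroSNF i j)))
  ... | inj₂ (r , c , Arc≢0) =
    fromSplit (splitsOffCorner-∼ A∼A′
      (splitsOffBelow ∣ A r c ∣ A′ (Arc≢0 ∘ trans (sym A′₀₀≡Arc)) (ℕₚ.≤-reflexive (cong ∣_∣ A′₀₀≡Arc))))
    where
    A′ = (rowPermutation (swap₀ r) ⊗ A) ⊗ columnPermutation (swap₀ c)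
    A∼A′ : A ∼ A′
    A∼A′ = mk∼ (rowPermutation (swap₀ r)) (columnPermutation (swap₀ c))
               (rowPermutation-unimodular (swap₀ r) (swap₀-involutive r))
               (columnPermutation-unimodular (swap₀ c) (swap₀-involutive c)) ≈M-refl
    A′₀₀≡Arc : A′ zero zero ≡ A r c
    A′₀₀≡Arc = trans (⊗-columnPermutation (swap₀ c) (rowPermutation (swap₀ r) ⊗ A) zero zero)
                     (rowPermutation-⊗ (swap₀ r) A zero c)
    fromSplit : SplitsOffCorner A → ∃ λ D → A ∼ snfMat D
    fromSplit (d , B , d>0 , d∣B , A∼d⊕B) with smithNormalForm B
    ... | D , B∼D = consSNF d d>0 D d∣e ,
      ∼-trans A∼d⊕B (∼-trans (⊕-∼ (+ d) B∼D) (≈M⇒∼ (≈M-sym (snfMat-consSNF d d>0 D d∣e))))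
      where d∣e = ∣-elementaryDivisors d∣B B∼D

  smithDecomposition : ∀ {m k} (A : Mat m k) → ∃ λ S → ∃ λ T → ∃ λ D → IsSNFVia A S T D
  smithDecomposition A with smithNormalForm A
  ... | D , mk∼ S T uS uT SAT≈D = S , T , D , uS , uT , SAT≈D

module SmithDecomposition where

  open import Data.Integer using (_+_; _*_)
  open MatrixAlgebra
  open DiagonalForms

  InSpan : ∀ {m k} → Mat m k → (Fin m → ℤ) → Set
  InSpan A u = ∃ λ z → ∀ r → u r ≡ (A *ᵥ z) r

  module _ {m k} {A : Mat m k} {S T D} (snf : IsSNFVia A S T D) where
    open SNFData D

    S⁻¹ : Mat m m
    S⁻¹ = proj₁ (proj₁ snf)

    T⁻¹ : Mat k k
    T⁻¹ = proj₁ (proj₁ (proj₂ snf))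

    private
      SS⁻¹≈I  = proj₁ (proj₂ (proj₁ snf))
      S⁻¹S≈I  = proj₂ (proj₂ (proj₁ snf))
      TT⁻¹≈I  = proj₁ (proj₂ (proj₁ (proj₂ snf)))
      T⁻¹T≈I  = proj₂ (proj₂ (proj₁ (proj₂ snf)))
      SAT≈D   = proj₂ (proj₂ snf)

    A⊗T≈S⁻¹⊗D : (A ⊗ T) ≈M (S⁻¹ ⊗ snfMat D)
    A⊗T≈S⁻¹⊗D =
      ≈M-trans (≈M-sym (⊗-identityˡ (A ⊗ T))) $
      ≈M-trans (⊗-congʳ (A ⊗ T) (≈M-sym S⁻¹S≈I)) $
      ≈M-trans (⊗-assoc S⁻¹ S (A ⊗ T)) $
      ⊗-congˡ S⁻¹ (≈M-trans (≈M-sym (⊗-assoc S A T)) SAT≈D)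

    S*A≡D*T⁻¹ : ∀ z ρ → (S *ᵥ (A *ᵥ z)) ρ ≡ (snfMat D *ᵥ (T⁻¹ *ᵥ z)) ρ
    S*A≡D*T⁻¹ z ρ = begin
      (S *ᵥ (A *ᵥ z)) ρ                 ≡⟨ *ᵥ-assoc S A z ρ ⟨
      ((S ⊗ A) *ᵥ z) ρ                  ≡⟨ *ᵥ-cong (≈M-refl {A = S ⊗ A}) TT⁻¹z≡z ρ ⟨
      ((S ⊗ A) *ᵥ (T *ᵥ (T⁻¹ *ᵥ z))) ρ ≡⟨ *ᵥ-assoc (S ⊗ A) T (T⁻¹ *ᵥ z) ρ ⟨
      (((S ⊗ A) ⊗ T) *ᵥ (T⁻¹ *ᵥ z)) ρ  ≡⟨ *ᵥ-cong SAT≈D (λ _ → refl) ρ ⟩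
      (snfMat D *ᵥ (T⁻¹ *ᵥ z)) ρ        ∎
      where
      open ≡-Reasoning
      TT⁻¹z≡z : ∀ l → (T *ᵥ (T⁻¹ *ᵥ z)) l ≡ z l
      TT⁻¹z≡z l = trans (sym (*ᵥ-assoc T T⁻¹ z l)) (trans (*ᵥ-cong TT⁻¹≈I (λ _ → refl) l) (*ᵥ-identityˡ z l))

    kernelVector : ℓ < k → ∃ λ t → (∀ r → (A *ᵥ t) r ≡ 0ℤ) × ∃ λ p → t p ≢ 0ℤ
    kernelVector ℓ<k = t , At≡0 , nonzero (all-or-counterexample (λ p → t p ℤ.≟ 0ℤ))
      where
      κ₀ = fromℕ< ℓ<k
      t : Fin k → ℤ
      t l = T l κ₀
      At≡0 : ∀ r → (A *ᵥ t) r ≡ 0ℤ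
      At≡0 r = trans (A⊗T≈S⁻¹⊗D r κ₀)
                     (ᵥ*-snfMat-beyondRank D (S⁻¹ r) κ₀ (ℕₚ.<-irrefl (Finₚ.toℕ-fromℕ< ℓ<k)))
      nonzero : (∀ p → t p ≡ 0ℤ) ⊎ ∃ (λ p → t p ≢ 0ℤ) → ∃ λ p → t p ≢ 0ℤ
      nonzero (inj₂ t≢0) = t≢0
      nonzero (inj₁ t≡0) = ⊥-elim (0≢1 (begin
        0ℤ                        ≡⟨ Σℤ-zero _ (λ l → trans (cong (T⁻¹ κ₀ l *_) (t≡0 l)) (ℤₚ.*-zeroʳ (T⁻¹ κ₀ l))) ⟨
        (T⁻¹ ⊗ T) κ₀ κ₀           ≡⟨ T⁻¹T≈I κ₀ κ₀ ⟩
        idM κ₀ κ₀                 ≡⟨ trans (idM≡δ κ₀ κ₀) (δ-refl κ₀) ⟩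
        1ℤ                        ∎))
        where
        open ≡-Reasoning
        0≢1 : 0ℤ ≢ 1ℤ
        0≢1 ()

    image-of-column : ∀ i r → (A *ᵥ (λ l → T l (ιₖ D i))) r ≡ + e i * S⁻¹ r (ιₘ D i)
    image-of-column i r = begin
      (A ⊗ T) r (ιₖ D i)               ≡⟨ A⊗T≈S⁻¹⊗D r (ιₖ D i) ⟩
      (S⁻¹ r ᵥ* snfMat D) (ιₖ D i)     ≡⟨ ᵥ*-snfMat-ι D (S⁻¹ r) i ⟩
      S⁻¹ r (ιₘ D i) * + e i          ≡⟨ ℤₚ.*-comm (S⁻¹ r (ιₘ D i)) (+ e i) ⟩
      + e i * S⁻¹ r (ιₘ D i)          ∎
      where open ≡-Reasoning

    InSpan⇒vanishesBeyondRank : ∀ {c} w → c ≢ 0ℤ → InSpan A (λ r → c * w r) →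
      ∀ ρ → ¬ toℕ ρ < ℓ → (S *ᵥ w) ρ ≡ 0ℤ
    InSpan⇒vanishesBeyondRank {c} w c≢0 (z , cw≡Az) ρ ρ≮ℓ with ℤₚ.i*j≡0⇒i≡0∨j≡0 c c*Sw≡0
      where
      c*Sw≡0 : c * (S *ᵥ w) ρ ≡ 0ℤ
      c*Sw≡0 = begin
        c * (S *ᵥ w) ρ                 ≡⟨ *ᵥ-*ˡ S c w ρ ⟨
        (S *ᵥ (λ r → c * w r)) ρ       ≡⟨ *ᵥ-cong (≈M-refl {A = S}) cw≡Az ρ ⟩
        (S *ᵥ (A *ᵥ z)) ρ              ≡⟨ S*A≡D*T⁻¹ z ρ ⟩
        (snfMat D *ᵥ (T⁻¹ *ᵥ z)) ρ     ≡⟨ snfMat-*ᵥ-beyondRank D (T⁻¹ *ᵥ z) ρ ρ≮ℓ ⟩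
        0ℤ                             ∎
        where open ≡-Reasoning
    ... | inj₁ c≡0  = ⊥-elim (c≢0 c≡0)
    ... | inj₂ Sw≡0 = Sw≡0

    vanishesBeyondRank⇒InSpan : ∀ {N} w → (∀ i → e i ∣ N) → (∀ ρ → ¬ toℕ ρ < ℓ → (S *ᵥ w) ρ ≡ 0ℤ) →
      InSpan A (λ r → + N * w r)
    vanishesBeyondRank⇒InSpan {N} w e∣N Sw≡0 = T *ᵥ V , λ r → sym (ATV≡Nw r)
      where
      q : Fin ℓ → ℕ
      q i = _∣_.quotient (e∣N i)
      V : Fin k → ℤ
      V = padTo 0ℤ (λ i → + q i * (S *ᵥ w) (ιₘ D i))
      regroup : ∀ e q x → e * (q * x) ≡ q * e * x
      regroup = solve-∀
      DV≡NSw : ∀ ρ → (snfMat D *ᵥ V) ρ ≡ + N * (S *ᵥ w) ρ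
      DV≡NSw ρ with inject≤-or-beyond ℓ≤m ρ
      ... | inj₂ ρ≮ℓ = trans (snfMat-*ᵥ-beyondRank D V ρ ρ≮ℓ)
                             (sym (trans (cong (+ N *_) (Sw≡0 ρ ρ≮ℓ)) (ℤₚ.*-zeroʳ (+ N))))
      ... | inj₁ (i , refl) = begin
        (snfMat D *ᵥ V) (ιₘ D i)               ≡⟨ snfMat-*ᵥ-ι D V i ⟩
        + e i * V (ιₖ D i)                     ≡⟨ cong (+ e i *_) (padTo-inject≤ 0ℤ _ ℓ≤k i) ⟩
        + e i * (+ q i * (S *ᵥ w) (ιₘ D i))    ≡⟨ regroup (+ e i) (+ q i) _ ⟩
        + q i * + e i * (S *ᵥ w) (ιₘ D i)      ≡⟨ cong (_* (S *ᵥ w) (ιₘ D i)) (ℤₚ.pos-* (q i) (e i)) ⟨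
        + (q i ℕ.* e i) * (S *ᵥ w) (ιₘ D i)    ≡⟨ cong (λ n → + n * (S *ᵥ w) (ιₘ D i)) (_∣_.equality (e∣N i)) ⟨
        + N * (S *ᵥ w) (ιₘ D i)                ∎
        where open ≡-Reasoning
      ATV≡Nw : ∀ r → (A *ᵥ (T *ᵥ V)) r ≡ + N * w r
      ATV≡Nw r = begin
        (A *ᵥ (T *ᵥ V)) r                    ≡⟨ *ᵥ-assoc A T V r ⟨
        ((A ⊗ T) *ᵥ V) r                     ≡⟨ *ᵥ-cong A⊗T≈S⁻¹⊗D (λ _ → refl) r ⟩
        ((S⁻¹ ⊗ snfMat D) *ᵥ V) r            ≡⟨ *ᵥ-assoc S⁻¹ (snfMat D) V r ⟩
        (S⁻¹ *ᵥ (snfMat D *ᵥ V)) r           ≡⟨ *ᵥ-cong (≈M-refl {A = S⁻¹}) DV≡NSw r ⟩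
        (S⁻¹ *ᵥ (λ ρ → + N * (S *ᵥ w) ρ)) r  ≡⟨ *ᵥ-*ˡ S⁻¹ (+ N) (S *ᵥ w) r ⟩
        + N * (S⁻¹ *ᵥ (S *ᵥ w)) r            ≡⟨ cong (+ N *_) (*ᵥ-assoc S⁻¹ S w r) ⟨
        + N * ((S⁻¹ ⊗ S) *ᵥ w) r             ≡⟨ cong (+ N *_) (trans (*ᵥ-cong S⁻¹S≈I (λ _ → refl) r) (*ᵥ-identityˡ w r)) ⟩
        + N * w r                            ∎
        where open ≡-Reasoning

    InSpan⇒elementaryDivisor∣ : ∀ {N} i → InSpan A (λ r → + N * S⁻¹ r (ιₘ D i)) → e i ∣ N
    InSpan⇒elementaryDivisor∣ {N} i (z , Nw≡Az) = ℤ∣.∣⇒∣ᵤ (ℤ∣.divides ((T⁻¹ *ᵥ z) (ιₖ D i)) N≡ye)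
      where
      ι = ιₘ D i
      N≡ye : + N ≡ (T⁻¹ *ᵥ z) (ιₖ D i) * + e i
      N≡ye = begin
        + N                                    ≡⟨ ℤₚ.*-identityʳ (+ N) ⟨
        + N * 1ℤ                               ≡⟨ cong (+ N *_) (trans (SS⁻¹≈I ι ι) (trans (idM≡δ ι ι) (δ-refl ι))) ⟨
        + N * (S ⊗ S⁻¹) ι ι                    ≡⟨ *ᵥ-*ˡ S (+ N) (λ r → S⁻¹ r ι) ι ⟨
        (S *ᵥ (λ r → + N * S⁻¹ r ι)) ι         ≡⟨ *ᵥ-cong (≈M-refl {A = S}) Nw≡Az ι ⟩
        (S *ᵥ (A *ᵥ z)) ι                      ≡⟨ S*A≡D*T⁻¹ z ι ⟩
        (snfMat D *ᵥ (T⁻¹ *ᵥ z)) ι             ≡⟨ snfMat-*ᵥ-ι D (T⁻¹ *ᵥ z) i ⟩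
        + e i * (T⁻¹ *ᵥ z) (ιₖ D i)            ≡⟨ ℤₚ.*-comm (+ e i) _ ⟩
        (T⁻¹ *ᵥ z) (ιₖ D i) * + e i            ∎
        where open ≡-Reasoning

    xA⊗T≡xS⁻¹⊗D : ∀ x j → ((x ᵥ* A) ᵥ* T) j ≡ ((x ᵥ* S⁻¹) ᵥ* snfMat D) j
    xA⊗T≡xS⁻¹⊗D x j = begin
      ((x ᵥ* A) ᵥ* T) j             ≡⟨ ᵥ*-assoc x A T j ⟩
      (x ᵥ* (A ⊗ T)) j              ≡⟨ ᵥ*-congʳ x A⊗T≈S⁻¹⊗D j ⟩
      (x ᵥ* (S⁻¹ ⊗ snfMat D)) j     ≡⟨ ᵥ*-assoc x S⁻¹ (snfMat D) j ⟨
      ((x ᵥ* S⁻¹) ᵥ* snfMat D) j    ∎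
      where open ≡-Reasoning

    xA⊗T-ι : ∀ x i → ((x ᵥ* A) ᵥ* T) (ιₖ D i) ≡ (x ᵥ* S⁻¹) (ιₘ D i) * + diagonal D (ιₘ D i)
    xA⊗T-ι x i = begin
      ((x ᵥ* A) ᵥ* T) (ιₖ D i)                        ≡⟨ xA⊗T≡xS⁻¹⊗D x (ιₖ D i) ⟩
      ((x ᵥ* S⁻¹) ᵥ* snfMat D) (ιₖ D i)               ≡⟨ ᵥ*-snfMat-ι D (x ᵥ* S⁻¹) i ⟩
      (x ᵥ* S⁻¹) (ιₘ D i) * + e i                     ≡⟨ cong (λ n → (x ᵥ* S⁻¹) (ιₘ D i) * + n) (diagonal-ι D i) ⟨
      (x ᵥ* S⁻¹) (ιₘ D i) * + diagonal D (ιₘ D i)    ∎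
      where open ≡-Reasoning

    annihilates⇒ : ∀ {Q} x → (∀ j → Q ∣ℤ (x ᵥ* A) j) → ∀ ρ → Q ∣ℤ (x ᵥ* S⁻¹) ρ * + diagonal D ρ
    annihilates⇒ {Q} x Q∣xA ρ with inject≤-or-beyond ℓ≤m ρ
    ... | inj₁ (i , refl) = subst (Q ∣ℤ_) (xA⊗T-ι x i) (∣-ᵥ* T Q∣xA (ιₖ D i))
    ... | inj₂ ρ≮ℓ =
      subst (Q ∣ℤ_) (sym (trans (cong (λ n → (x ᵥ* S⁻¹) ρ * + n) (diagonal-beyondRank D ρ ρ≮ℓ))
                               (ℤₚ.*-zeroʳ ((x ᵥ* S⁻¹) ρ))))
            (ℤ∣.divides 0ℤ refl)

    annihilates⇐ : ∀ {Q} x → (∀ ρ → Q ∣ℤ (x ᵥ* S⁻¹) ρ * + diagonal D ρ) → ∀ j → Q ∣ℤ (x ᵥ* A) j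
    annihilates⇐ {Q} x Q∣yE j = subst (Q ∣ℤ_) xATT⁻¹≡xA (∣-ᵥ* T⁻¹ Q∣xAT j)
      where
      Q∣xAT : ∀ κ → Q ∣ℤ ((x ᵥ* A) ᵥ* T) κ
      Q∣xAT κ with inject≤-or-beyond ℓ≤k κ
      ... | inj₁ (i , refl) = subst (Q ∣ℤ_) (sym (xA⊗T-ι x i)) (Q∣yE (ιₘ D i))
      ... | inj₂ κ≮ℓ =
        subst (Q ∣ℤ_) (sym (trans (xA⊗T≡xS⁻¹⊗D x κ) (ᵥ*-snfMat-beyondRank D (x ᵥ* S⁻¹) κ κ≮ℓ))) (ℤ∣.divides 0ℤ refl)
      xATT⁻¹≡xA : (((x ᵥ* A) ᵥ* T) ᵥ* T⁻¹) j ≡ (x ᵥ* A) j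
      xATT⁻¹≡xA = trans (ᵥ*-assoc (x ᵥ* A) T T⁻¹ j)
                        (trans (ᵥ*-congʳ (x ᵥ* A) TT⁻¹≈I j) (ᵥ*-identityʳ (x ᵥ* A) j))

module ColumnSelection where

  open import Data.Integer using (_+_; _*_; _-_)
  open MatrixAlgebra
  open SmithDecomposition using (InSpan)

  _∉J_ : ∀ {n} → Fin n → Vec Bool n → Set
  j ∉J J = lookup J j ≡ false

  card≤length : ∀ {n} (J : Vec Bool n) → card J ≤ n
  card≤length []          = z≤n
  card≤length (true ∷ J)  = s≤s (card≤length J)
  card≤length (false ∷ J) = ℕₚ.m≤n⇒m≤1+n (card≤length J)

  sel-∈ : ∀ {n} (J : Vec Bool n) k → sel J k ∈J J
  sel-∈ (true ∷ J)  zero    = refl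
  sel-∈ (true ∷ J)  (suc k) = sel-∈ J k
  sel-∈ (false ∷ J) k       = sel-∈ J k

  ∈⇒sel : ∀ {n} (J : Vec Bool n) j → j ∈J J → ∃ λ k → sel J k ≡ j
  ∈⇒sel (true ∷ J)  zero    _   = zero , refl
  ∈⇒sel (true ∷ J)  (suc j) j∈J = let k , k↦j = ∈⇒sel J j j∈J in suc k , cong suc k↦j
  ∈⇒sel (false ∷ J) (suc j) j∈J = let k , k↦j = ∈⇒sel J j j∈J in k , cong suc k↦j

  remove : ∀ {n} → Vec Bool n → Fin n → Vec Bool n
  remove (b ∷ J) zero    = false ∷ J
  remove (b ∷ J) (suc j) = b ∷ remove J j

  card-remove : ∀ {n} (J : Vec Bool n) j → j ∈J J → suc (card (remove J j)) ≡ card J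
  card-remove (true ∷ J)  zero    _   = refl
  card-remove (true ∷ J)  (suc j) j∈J = cong suc (card-remove J j j∈J)
  card-remove (false ∷ J) (suc j) j∈J = card-remove J j j∈J

  ∉-remove : ∀ {n} (J : Vec Bool n) j₀ j → j ∉J remove J j₀ → j ≡ j₀ ⊎ j ∉J J
  ∉-remove (b ∷ J) zero     zero    _ = inj₁ refl
  ∉-remove (b ∷ J) zero     (suc j) j∉ = inj₂ j∉
  ∉-remove (b ∷ J) (suc j₀) zero    j∉ = inj₂ j∉
  ∉-remove (b ∷ J) (suc j₀) (suc j) j∉ with ∉-remove J j₀ j j∉
  ... | inj₁ j≡j₀ = inj₁ (cong suc j≡j₀)
  ... | inj₂ j∉J  = inj₂ j∉J

  ∉⇒∉-remove : ∀ {n} (J : Vec Bool n) j₀ j → j ∉J J → j ∉J remove J j₀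
  ∉⇒∉-remove (b ∷ J) zero     zero    _   = refl
  ∉⇒∉-remove (b ∷ J) zero     (suc j) j∉J = j∉J
  ∉⇒∉-remove (b ∷ J) (suc j₀) zero    j∉J = j∉J
  ∉⇒∉-remove (b ∷ J) (suc j₀) (suc j) j∉J = ∉⇒∉-remove J j₀ j j∉J

  extendByZero : ∀ {n} (J : Vec Bool n) → (Fin (card J) → ℤ) → Fin n → ℤ
  extendByZero (true ∷ J)  z zero    = z zero
  extendByZero (true ∷ J)  z (suc j) = extendByZero J (z ∘ suc) j
  extendByZero (false ∷ J) z zero    = 0ℤ
  extendByZero (false ∷ J) z (suc j) = extendByZero J z j

  Σℤ-extendByZero : ∀ {n} (J : Vec Bool n) (f : Fin n → ℤ) z →
    Σℤ (λ j → f j * extendByZero J z j) ≡ Σℤ (λ k → f (sel J k) * z k)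
  Σℤ-extendByZero []          f z = refl
  Σℤ-extendByZero (true ∷ J)  f z = cong (λ w → f zero * z zero + w) (Σℤ-extendByZero J (f ∘ suc) (z ∘ suc))
  Σℤ-extendByZero (false ∷ J) f z =
    trans (cong (_+ Σℤ (λ j → f (suc j) * extendByZero J z j)) (ℤₚ.*-zeroʳ (f zero)))
          (trans (ℤₚ.+-identityˡ _) (Σℤ-extendByZero J (f ∘ suc) z))

  extendByZero-sel : ∀ {n} (J : Vec Bool n) z k → extendByZero J z (sel J k) ≡ z k
  extendByZero-sel (true ∷ J)  z zero    = refl
  extendByZero-sel (true ∷ J)  z (suc k) = extendByZero-sel J (z ∘ suc) k
  extendByZero-sel (false ∷ J) z k       = extendByZero-sel J z k

  extendByZero-∉ : ∀ {n} (J : Vec Bool n) z j → j ∉J J → extendByZero J z j ≡ 0ℤ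
  extendByZero-∉ (true ∷ J)  z (suc j) j∉J = extendByZero-∉ J (z ∘ suc) j j∉J
  extendByZero-∉ (false ∷ J) z zero    _   = refl
  extendByZero-∉ (false ∷ J) z (suc j) j∉J = extendByZero-∉ J z j j∉J

  extendByZero-restrict : ∀ {n} (J : Vec Bool n) (z : Fin n → ℤ) → (∀ j → j ∉J J → z j ≡ 0ℤ) →
    ∀ j → extendByZero J (z ∘ sel J) j ≡ z j
  extendByZero-restrict (true ∷ J)  z z∉≡0 zero    = refl
  extendByZero-restrict (true ∷ J)  z z∉≡0 (suc j) = extendByZero-restrict J (z ∘ suc) (z∉≡0 ∘ suc) j
  extendByZero-restrict (false ∷ J) z z∉≡0 zero    = sym (z∉≡0 zero refl)
  extendByZero-restrict (false ∷ J) z z∉≡0 (suc j) = extendByZero-restrict J (z ∘ suc) (z∉≡0 ∘ suc) j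

  module _ {m n : ℕ} (C : Mat m n) where

    SpannedBy : Vec Bool n → (Fin m → ℤ) → Set
    SpannedBy J u = ∃ λ z → (∀ j → j ∉J J → z j ≡ 0ℤ) × (∀ r → u r ≡ (C *ᵥ z) r)

    SpannedBy-cong : ∀ J {u u′} → (∀ r → u r ≡ u′ r) → SpannedBy J u → SpannedBy J u′
    SpannedBy-cong J u≗u′ (z , z∉≡0 , u≡Cz) = z , z∉≡0 , λ r → trans (sym (u≗u′ r)) (u≡Cz r)

    InSpan⇒SpannedBy : ∀ J {u} → InSpan (sub C J) u → SpannedBy J u
    InSpan⇒SpannedBy J (z , u≡Az) =
      extendByZero J z , extendByZero-∉ J z , λ r → trans (u≡Az r) (sym (Σℤ-extendByZero J (C r) z))

    SpannedBy⇒InSpan : ∀ J {u} → SpannedBy J u → InSpan (sub C J) u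
    SpannedBy⇒InSpan J (z , z∉≡0 , u≡Cz) = z ∘ sel J , λ r → begin
      _                                           ≡⟨ u≡Cz r ⟩
      Σℤ (λ j → C r j * z j)                      ≡⟨ Σℤ-cong (λ j → cong (C r j *_) (extendByZero-restrict J z z∉≡0 j)) ⟨
      Σℤ (λ j → C r j * extendByZero J (z ∘ sel J) j) ≡⟨ Σℤ-extendByZero J (C r) (z ∘ sel J) ⟩
      (sub C J *ᵥ (z ∘ sel J)) r                 ∎
      where open ≡-Reasoning

    SpannedBy-remove⇒SpannedBy : ∀ J j₀ {u} → SpannedBy (remove J j₀) u → SpannedBy J u
    SpannedBy-remove⇒SpannedBy J j₀ (z , z∉≡0 , u≡Cz) = z , (λ j j∉J → z∉≡0 j (∉⇒∉-remove J j₀ j j∉J)) , u≡Cz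

    SpannedBy-remove : ∀ J (τ : Fin n → ℤ) → (∀ j → j ∉J J → τ j ≡ 0ℤ) → (∀ r → (C *ᵥ τ) r ≡ 0ℤ) →
      ∀ j₀ {u} → SpannedBy J u → SpannedBy (remove J j₀) (λ r → τ j₀ * u r)
    SpannedBy-remove J τ τ∉≡0 Cτ≡0 j₀ {u} (z , z∉≡0 , u≡Cz) = z′ , z′∉≡0 , τu≡Cz′
      where
      z′ : Fin n → ℤ
      z′ j = τ j₀ * z j - z j₀ * τ j
      z′∉≡0 : ∀ j → j ∉J remove J j₀ → z′ j ≡ 0ℤ
      z′∉≡0 j j∉ with ∉-remove J j₀ j j∉
      ... | inj₁ refl = cancel (τ j₀) (z j₀)
        where
        cancel : ∀ a b → a * b - b * a ≡ 0ℤ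
        cancel = solve-∀
      ... | inj₂ j∉J = begin
        τ j₀ * z j - z j₀ * τ j   ≡⟨ cong₂ (λ x y → τ j₀ * x - z j₀ * y) (z∉≡0 j j∉J) (τ∉≡0 j j∉J) ⟩
        τ j₀ * 0ℤ - z j₀ * 0ℤ     ≡⟨ vanish (τ j₀) (z j₀) ⟩
        0ℤ                        ∎
        where
        open ≡-Reasoning
        vanish : ∀ a b → a * 0ℤ - b * 0ℤ ≡ 0ℤ
        vanish = solve-∀
      linear : ∀ x y t a b → x * (a * y - b * t) ≡ a * (x * y) + - (b * (x * t))
      linear = solve-∀
      τu≡Cz′ : ∀ r → τ j₀ * u r ≡ (C *ᵥ z′) r
      τu≡Cz′ r = sym (begin
        Σℤ (λ j → C r j * z′ j)
          ≡⟨ Σℤ-cong (λ j → linear (C r j) (z j) (τ j) (τ j₀) (z j₀)) ⟩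
        Σℤ (λ j → τ j₀ * (C r j * z j) + - (z j₀ * (C r j * τ j)))
          ≡⟨ Σℤ-+ (λ j → τ j₀ * (C r j * z j)) (λ j → - (z j₀ * (C r j * τ j))) ⟩
        Σℤ (λ j → τ j₀ * (C r j * z j)) + Σℤ (λ j → - (z j₀ * (C r j * τ j)))
          ≡⟨ cong₂ _+_ (Σℤ-*ˡ (τ j₀) (λ j → C r j * z j))
                       (trans (Σℤ-neg (λ j → z j₀ * (C r j * τ j))) (cong -_ (Σℤ-*ˡ (z j₀) (λ j → C r j * τ j)))) ⟩
        τ j₀ * (C *ᵥ z) r + - (z j₀ * (C *ᵥ τ) r)
          ≡⟨ cong₂ (λ x y → τ j₀ * x + - (z j₀ * y)) (sym (u≡Cz r)) (Cτ≡0 r) ⟩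
        τ j₀ * u r + - (z j₀ * 0ℤ)
          ≡⟨ drop (τ j₀) (u r) (z j₀) ⟩
        τ j₀ * u r ∎)
        where
        open ≡-Reasoning
        drop : ∀ a u b → a * u + - (b * 0ℤ) ≡ a * u
        drop = solve-∀

module ElementaryDivisorBound {m n : ℕ} (C : Mat m n) where

  open import Data.Integer using (_*_)
  open MatrixAlgebra
  open DiagonalForms
  open SmithNormalFormExistence using (smithDecomposition)
  open SmithDecomposition
  open ColumnSelection

  ElementaryDivisorsDivide : Vec Bool n → ℕ → Set
  ElementaryDivisorsDivide J N = ∀ S T D → IsSNFVia (sub C J) S T D → ∀ i → SNFData.e D i ∣ N

  -- A kernel vector of C_J removes one column at the cost of a nonzero factor, which the
  -- divisibility by the elementary divisors of the smaller matrix then absorbs.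
  dependentColumns : ∀ J {N} → (∀ J₀ → suc (card J₀) ≡ card J → ElementaryDivisorsDivide J₀ N) →
    ∀ S T D → IsSNFVia (sub C J) S T D → SNFData.ℓ D < card J → ∀ i → SNFData.e D i ∣ N
  dependentColumns J {N} divides₀ S T D snf ℓ<|J| i = InSpan⇒elementaryDivisor∣ snf i Nw∈span
    where
    open SNFData D
    kernel = kernelVector snf ℓ<|J|
    t = proj₁ kernel
    p = proj₁ (proj₂ (proj₂ kernel))
    τ = extendByZero J t
    j₀ = sel J p
    Cτ≡0 : ∀ r → (C *ᵥ τ) r ≡ 0ℤ
    Cτ≡0 r = trans (Σℤ-extendByZero J (C r) t) (proj₁ (proj₂ kernel) r)
    c = t p * + e i
    c≢0 : c ≢ 0ℤ
    c≢0 c≡0 with ℤₚ.i*j≡0⇒i≡0∨j≡0 (t p) c≡0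
    ... | inj₁ tp≡0 = proj₂ (proj₂ (proj₂ kernel)) tp≡0
    ... | inj₂ eᵢ≡0 = ℕₚ.<-irrefl (sym (cong ∣_∣ eᵢ≡0)) (e-pos i)
    w : Fin m → ℤ
    w r = S⁻¹ snf r (ιₘ D i)
    J₀ = remove J j₀
    cw∈J₀ : SpannedBy C J₀ (λ r → c * w r)
    cw∈J₀ = SpannedBy-cong C J₀ (λ r → trans (cong (_* (+ e i * w r)) (extendByZero-sel J t p))
                                          (sym (ℤₚ.*-assoc (t p) (+ e i) (w r))))
              (SpannedBy-remove C J τ (extendByZero-∉ J t) Cτ≡0 j₀
                (InSpan⇒SpannedBy C J (_ , λ r → sym (image-of-column snf i r))))
    decomposition₀ = smithDecomposition (sub C J₀)
    snf₀ = proj₂ (proj₂ (proj₂ decomposition₀))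
    Nw∈J₀ : InSpan (sub C J₀) (λ r → + N * w r)
    Nw∈J₀ = vanishesBeyondRank⇒InSpan snf₀ w
      (divides₀ J₀ (card-remove J j₀ (sel-∈ J p)) _ _ _ snf₀)
      (InSpan⇒vanishesBeyondRank snf₀ w c≢0 (SpannedBy⇒InSpan C J₀ cw∈J₀))
    Nw∈span : InSpan (sub C J) (λ r → + N * w r)
    Nw∈span = SpannedBy⇒InSpan C J (SpannedBy-remove⇒SpannedBy C J j₀ (InSpan⇒SpannedBy C J₀ Nw∈J₀))

  lastIndex : ∀ {ℓ} (i : Fin ℓ) → ∃ λ (l : Fin ℓ) → suc (toℕ l) ≡ ℓ × toℕ i ≤ toℕ l
  lastIndex {suc ℓ} i =
    Fin.fromℕ ℓ , cong suc (Finₚ.toℕ-fromℕ ℓ) , subst (toℕ i ≤_) (sym (Finₚ.toℕ-fromℕ ℓ)) (Finₚ.toℕ≤pred[n] i)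

  module _ {ρ₀ : ℕ} (isρ₀ : IsRho0 C ρ₀) where

    fewColumns∣ρ₀ : ∀ J → card J ≤ m → ElementaryDivisorsDivide J ρ₀
    fewColumns∣ρ₀ J |J|≤m S T D snf i =
      ∣-trans (chain i l i≤l)
        (proj₁ isρ₀ J (e l) 1≤|J| (ℕₚ.⊓-glb |J|≤m (card≤length J)) (S , T , D , snf , l , l-last , refl))
      where
      open SNFData D
      l = proj₁ (lastIndex i)
      l-last = proj₁ (proj₂ (lastIndex i))
      i≤l = proj₂ (proj₂ (lastIndex i))
      1≤|J| : 1 ≤ card J
      1≤|J| = ℕₚ.≤-trans (s≤s z≤n) (ℕₚ.≤-trans (Finₚ.toℕ<n i) ℓ≤k)

    elementaryDivisors∣ρ₀ : ∀ J → ElementaryDivisorsDivide J ρ₀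
    elementaryDivisors∣ρ₀ J = bounded (card J) J ℕₚ.≤-refl
      where
      bounded : ∀ b J → card J ≤ b → ElementaryDivisorsDivide J ρ₀
      bounded zero    J |J|≤0   = fewColumns∣ρ₀ J (ℕₚ.≤-trans |J|≤0 z≤n)
      bounded (suc b) J |J|≤1+b S T D snf with card J ℕ.≤? m
      ... | yes |J|≤m = fewColumns∣ρ₀ J |J|≤m S T D snf
      ... | no  |J|≰m = dependentColumns J smaller S T D snf (ℕₚ.≤-<-trans (SNFData.ℓ≤m D) (ℕₚ.≰⇒> |J|≰m))
        where
        smaller : ∀ J₀ → suc (card J₀) ≡ card J → ElementaryDivisorsDivide J₀ ρ₀
        smaller J₀ |J₀|+1≡|J| = bounded b J₀ (ℕₚ.≤-pred (subst (_≤ suc b) (sym |J₀|+1≡|J|) |J|≤1+b))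

module AnnihilatorInclusion where

  open import Data.Nat using (_+_; _*_)
  open import Data.Nat.Divisibility
    using (∣-antisym; _∣0; ∣m∣n⇒∣m+n; ∣m+n∣m⇒∣n; n∣m*n; ∣n⇒∣m*n; *-monoʳ-∣; *-cancelˡ-∣; ∣⇒≤)
  open import Data.Nat.GCD using (gcd; gcd[m,n]∣m; gcd[m,n]∣n; gcd-greatest; c*gcd[m,n]≡gcd[cm,cn])
  open import Algebra.Properties.CommutativeSemigroup ℕₚ.*-commutativeSemigroup using (x∙yz≈y∙xz)
  import Function.Properties.Equivalence as ⇔

  -- Ann(e) ⊆ Ann(b) in ℤ_Q
  AnnihilatorIncluded : ℕ → ℕ → ℕ → Set
  AnnihilatorIncluded Q e b = ∀ y → Q ∣ y * e → Q ∣ y * b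

  annihilatorIncluded⇔gcd∣ : ∀ {Q e b} → 0 < Q → AnnihilatorIncluded Q e b ⇔ gcd Q e ∣ b
  annihilatorIncluded⇔gcd∣ {Q} {e} {b} Q>0 = mk⇔ to from
    where
    g = gcd Q e
    from : g ∣ b → AnnihilatorIncluded Q e b
    from g∣b y Q∣ye = ∣-trans Q∣yg (*-monoʳ-∣ y g∣b)
      where
      Q∣yg : Q ∣ y * g
      Q∣yg = subst (Q ∣_) (sym (c*gcd[m,n]≡gcd[cm,cn] y Q e)) (gcd-greatest (n∣m*n y) Q∣ye)
    to : AnnihilatorIncluded Q e b → g ∣ b
    to incl with gcd[m,n]∣m Q e | gcd[m,n]∣n Q e
    ... | divides Q′ Q≡Q′g | divides e′ e≡e′g =
      *-cancelˡ-∣ Q′ {{ℕ.≢-nonZero Q′≢0}} (subst (_∣ Q′ * b) Q≡Q′g (incl Q′ Q∣Q′e))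
      where
      Q′≢0 : Q′ ≢ 0
      Q′≢0 Q′≡0 = ℕₚ.<-irrefl (sym (trans Q≡Q′g (cong (_* g) Q′≡0))) Q>0
      Q∣Q′e : Q ∣ Q′ * e
      Q∣Q′e = divides e′ (begin
        Q′ * e         ≡⟨ cong (Q′ *_) e≡e′g ⟩
        Q′ * (e′ * g)  ≡⟨ x∙yz≈y∙xz Q′ e′ g ⟩
        e′ * (Q′ * g)  ≡⟨ cong (e′ *_) Q≡Q′g ⟨
        e′ * Q         ∎)
        where open ≡-Reasoning

  annihilatorIncluded-zero⇔ : ∀ {Q b} → b < Q → AnnihilatorIncluded Q 0 b ⇔ b ≡ 0
  annihilatorIncluded-zero⇔ {Q} {b} b<Q = mk⇔ to from
    where
    from : b ≡ 0 → AnnihilatorIncluded Q 0 b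
    from refl y _ = subst (Q ∣_) (sym (ℕₚ.*-zeroʳ y)) (Q ∣0)
    to : AnnihilatorIncluded Q 0 b → b ≡ 0
    to incl with b ℕ.≟ 0
    ... | yes b≡0 = b≡0
    ... | no  b≢0 = ⊥-elim (ℕₚ.<-irrefl refl (ℕₚ.<-≤-trans b<Q (∣⇒≤ {{ℕ.≢-nonZero b≢0}} Q∣b)))
      where
      Q∣b : Q ∣ b
      Q∣b = subst (Q ∣_) (ℕₚ.*-identityˡ b) (incl 1 (subst (Q ∣_) (sym (ℕₚ.*-zeroʳ 1)) (Q ∣0)))

  gcd-periodic : ∀ Q s {ρ e} → e ∣ ρ → gcd (Q + s * ρ) e ≡ gcd Q e
  gcd-periodic Q s {ρ} {e} e∣ρ = ∣-antisym
    (gcd-greatest g′∣Q (gcd[m,n]∣n (Q + s * ρ) e))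
    (gcd-greatest (∣m∣n⇒∣m+n (gcd[m,n]∣m Q e) (∣n⇒∣m*n s (∣-trans (gcd[m,n]∣n Q e) e∣ρ))) (gcd[m,n]∣n Q e))
    where
    g′ = gcd (Q + s * ρ) e
    g′∣Q : g′ ∣ Q
    g′∣Q = ∣m+n∣m⇒∣n (subst (g′ ∣_) (ℕₚ.+-comm Q (s * ρ)) (gcd[m,n]∣m (Q + s * ρ) e))
                     (∣n⇒∣m*n s (∣-trans (gcd[m,n]∣n (Q + s * ρ) e) e∣ρ))

  -- b ≤ q₀ < q is what makes the case e = 0 periodic as well.
  annihilatorIncluded-periodic : ∀ {q₀ q ρ e b} s → q₀ < q → b ≤ q₀ → e ≡ 0 ⊎ e ∣ ρ →
    AnnihilatorIncluded q e b ⇔ AnnihilatorIncluded (q + s * ρ) e b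
  annihilatorIncluded-periodic {q = q} {ρ} s q₀<q b≤q₀ (inj₁ refl) =
    ⇔.trans (annihilatorIncluded-zero⇔ b<q)
            (⇔.sym (annihilatorIncluded-zero⇔ (ℕₚ.<-≤-trans b<q (ℕₚ.m≤m+n q (s * ρ)))))
    where b<q = ℕₚ.≤-<-trans b≤q₀ q₀<q
  annihilatorIncluded-periodic {q = q} {ρ} {e} {b} s q₀<q b≤q₀ (inj₂ e∣ρ) =
    ⇔.trans (annihilatorIncluded⇔gcd∣ q>0)
            (⇔.sym (⇔.trans (annihilatorIncluded⇔gcd∣ (ℕₚ.<-≤-trans q>0 (ℕₚ.m≤m+n q (s * ρ))))
                            (mk⇔ (subst (_∣ b) (gcd-periodic q s e∣ρ)) (subst (_∣ b) (sym (gcd-periodic q s e∣ρ))))))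
    where q>0 = ℕₚ.≤-<-trans z≤n q₀<q

module FiniteSearch where

  import Data.Vec.Functional as Vector
  open import Data.Nat using (_⊔_)

  max-attained : ∀ {k} (g : Fin (suc k) → ℕ) → ∃ λ v → (∀ i → g i ≤ v) × ∃ λ i → g i ≡ v
  max-attained {zero}  g = g zero , (λ { zero → ℕₚ.≤-refl }) , zero , refl
  max-attained {suc k} g = extend (max-attained (g ∘ suc))
    where
    extend : (∃ λ v → (∀ i → g (suc i) ≤ v) × ∃ λ i → g (suc i) ≡ v) → ∃ λ v → (∀ i → g i ≤ v) × ∃ λ i → g i ≡ v
    extend (v , g≤v , i , gi≡v) = g zero ⊔ v , bound , attained (ℕₚ.⊔-sel (g zero) v)
      where
      bound : ∀ i → g i ≤ g zero ⊔ v
      bound zero    = ℕₚ.m≤m⊔n (g zero) v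
      bound (suc i) = ℕₚ.≤-trans (g≤v i) (ℕₚ.m≤n⊔m (g zero) v)
      attained : g zero ⊔ v ≡ g zero ⊎ g zero ⊔ v ≡ v → ∃ λ i → g i ≡ g zero ⊔ v
      attained (inj₁ ⊔≡g₀) = zero , sym ⊔≡g₀
      attained (inj₂ ⊔≡v)  = suc i , trans gi≡v (sym ⊔≡v)

  nonzeroColumn⇒row : ∀ {m n} (C : Mat m n) j → ¬ (∀ i → C i j ≡ 0ℤ) → Fin m
  nonzeroColumn⇒row {zero}  C j C≢0 = ⊥-elim (C≢0 (λ ()))
  nonzeroColumn⇒row {suc m} C j _   = zero

  maxEntry : ∀ {m n} (C : Mat m n) (S : Mat m m) → Fin m → Fin n → ∃ (MaxEntry C S)
  maxEntry {suc m} {suc n} C S _ _ =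
    v , (λ i j → split (bound i j)) , i , j , attained (ℕₚ.⊔-sel ∣ (S ⊗ C) i j ∣ ∣ C i j ∣)
    where
    f : Fin (suc m) → Fin (suc n) → ℕ
    f i j = ∣ (S ⊗ C) i j ∣ ⊔ ∣ C i j ∣
    rowMax = λ i → max-attained (f i)
    overall = max-attained (λ i → proj₁ (rowMax i))
    v = proj₁ overall
    i = proj₁ (proj₂ (proj₂ overall))
    j = proj₁ (proj₂ (proj₂ (rowMax i)))
    bound : ∀ i j → f i j ≤ v
    bound i j = ℕₚ.≤-trans (proj₁ (proj₂ (rowMax i)) j) (proj₁ (proj₂ overall) i)
    split : ∀ {a b} → a ⊔ b ≤ v → a ≤ v × b ≤ v
    split {a} {b} a⊔b≤v = ℕₚ.≤-trans (ℕₚ.m≤m⊔n a b) a⊔b≤v , ℕₚ.≤-trans (ℕₚ.m≤n⊔m a b) a⊔b≤v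
    fij≡v : f i j ≡ v
    fij≡v = trans (proj₂ (proj₂ (proj₂ (rowMax i)))) (proj₂ (proj₂ (proj₂ overall)))
    attained : f i j ≡ ∣ (S ⊗ C) i j ∣ ⊎ f i j ≡ ∣ C i j ∣ → ∣ (S ⊗ C) i j ∣ ≡ v ⊎ ∣ C i j ∣ ≡ v
    attained (inj₁ f≡SC) = inj₁ (trans (sym f≡SC) fij≡v)
    attained (inj₂ f≡C)  = inj₂ (trans (sym f≡C) fij≡v)

  ¬¬-least : ∀ (P : ℕ → Set) {n} → P n → ¬ ¬ (∃ λ w → P w × ∀ v → P v → w ≤ v)
  ¬¬-least P {n} Pn ¬least = noneBelow (suc n) n ℕₚ.≤-refl Pn
    where
    noneBelow : ∀ b v → v < b → ¬ P v
    noneBelow (suc b) v (s≤s v≤b) Pv =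
      ¬least (v , Pv , λ u Pu → ℕₚ.≮⇒≥ (λ u<v → noneBelow b u (ℕₚ.<-≤-trans u<v v≤b) Pu))

  ∀-functions? : ∀ m {Q} {P : (Fin m → Fin Q) → Set} → (∀ {x y} → (∀ i → x i ≡ y i) → P x → P y) →
    (∀ x → Dec (P x)) → Dec (∀ x → P x)
  ∀-functions? zero P-ext P? with P? (λ ())
  ... | yes P₀ = yes (λ x → P-ext (λ ()) P₀)
  ... | no ¬P₀ = no (λ ∀P → ¬P₀ (∀P (λ ())))
  ∀-functions? (suc m) {Q} {P} P-ext P?
    with Finₚ.all? (λ a → ∀-functions? m (P-ext ∘ cons-cong a) (λ x → P? (a Vector.∷ x)))
    where
    cons-cong : ∀ a {x y : Fin m → Fin Q} → (∀ i → x i ≡ y i) → ∀ i → (a Vector.∷ x) i ≡ (a Vector.∷ y) i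
    cons-cong a x≗y zero    = refl
    cons-cong a x≗y (suc i) = x≗y i
  ... | yes ∀P = yes (λ x → P-ext (λ { zero → refl ; (suc i) → refl }) (∀P (x zero) (x ∘ suc)))
  ... | no ¬∀P = no (λ ∀P → ¬∀P (λ a x → ∀P (a Vector.∷ x)))

module HyperplaneConditions {m n : ℕ} (C : Mat m n) where

  open import Data.Integer using (_+_; _*_)
  import Data.Integer.DivMod as ℤ÷
  import Data.Bool as Bool
  open import Relation.Nullary.Decidable using (_→-dec_)
  open MatrixAlgebra
  open DiagonalForms
  open SmithDecomposition
  open ColumnSelection
  open AnnihilatorInclusion
  open FiniteSearch using (∀-functions?)

  embed : ∀ {Q} → (Fin m → Fin Q) → Fin m → ℤ
  embed x i = + toℕ (x i)

  -- the preimage of H_{J,Q} in ℤ^m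
  Annihilates : ℕ → Vec Bool n → (Fin m → ℤ) → Set
  Annihilates Q J x = ∀ j → j ∈J J → + Q ∣ℤ (x ᵥ* C) j

  InH⇒Annihilates : ∀ {Q} J x → InH C Q J x → Annihilates Q J (embed x)
  InH⇒Annihilates J x x∈H j j∈J = ℤ∣.∣ᵤ⇒∣ (x∈H j j∈J)

  Annihilates⇒InH : ∀ {Q} J x → Annihilates Q J (embed x) → InH C Q J x
  Annihilates⇒InH J x ann j j∈J = ℤ∣.∣⇒∣ᵤ (ann j j∈J)

  Annihilates⇒annihilates-sub : ∀ {Q} J x → Annihilates Q J x → ∀ k → + Q ∣ℤ (x ᵥ* sub C J) k
  Annihilates⇒annihilates-sub J x ann k = ann (sel J k) (sel-∈ J k)

  annihilates-sub⇒Annihilates : ∀ {Q} J x → (∀ k → + Q ∣ℤ (x ᵥ* sub C J) k) → Annihilates Q J x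
  annihilates-sub⇒Annihilates J x ann j j∈J with ∈⇒sel J j j∈J
  ... | k , refl = ann k

  reduceMod : ∀ Q → (Fin m → ℤ) → Fin m → Fin (suc Q)
  reduceMod Q x i = fromℕ< (ℤ÷.n%d<d (x i) (+ suc Q))

  reduceMod-ᵥ* : ∀ Q x j →
    (x ᵥ* C) j ≡ (embed (reduceMod Q x) ᵥ* C) j + + suc Q * Σℤ (λ i → (x i ℤ./ + suc Q) * C i j)
  reduceMod-ᵥ* Q x j = begin
    Σℤ (λ i → x i * C i j)
      ≡⟨ Σℤ-cong (λ i → cong (_* C i j) (x≡r+qQ i)) ⟩
    Σℤ (λ i → (r i + q i * + suc Q) * C i j)
      ≡⟨ Σℤ-cong (λ i → regroup (r i) (q i) (+ suc Q) (C i j)) ⟩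
    Σℤ (λ i → r i * C i j + + suc Q * (q i * C i j))
      ≡⟨ Σℤ-+ (λ i → r i * C i j) (λ i → + suc Q * (q i * C i j)) ⟩
    Σℤ (λ i → r i * C i j) + Σℤ (λ i → + suc Q * (q i * C i j))
      ≡⟨ cong (λ z → Σℤ (λ i → r i * C i j) + z) (Σℤ-*ˡ (+ suc Q) (λ i → q i * C i j)) ⟩
    (r ᵥ* C) j + + suc Q * Σℤ (λ i → q i * C i j) ∎
    where
    open ≡-Reasoning
    r = embed (reduceMod Q x)
    q : Fin m → ℤ
    q i = x i ℤ./ + suc Q
    x≡r+qQ : ∀ i → x i ≡ r i + q i * + suc Q
    x≡r+qQ i = trans (ℤ÷.a≡a%n+[a/n]*n (x i) (+ suc Q))
                     (cong (λ n → + n + q i * + suc Q) (sym (Finₚ.toℕ-fromℕ< (ℤ÷.n%d<d (x i) (+ suc Q)))))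
    regroup : ∀ r q Q c → (r + q * Q) * c ≡ r * c + Q * (q * c)
    regroup = solve-∀

  Annihilates⇒reduceMod : ∀ {Q J} x → Annihilates (suc Q) J x → Annihilates (suc Q) J (embed (reduceMod Q x))
  Annihilates⇒reduceMod {Q} x ann j j∈J =
    ℤ∣.∣m+n∣n⇒∣m (subst (+ suc Q ∣ℤ_) (reduceMod-ᵥ* Q x j) (ann j j∈J)) (ℤ∣.∣m⇒∣m*n _ ℤ∣.∣-refl)

  reduceMod⇒Annihilates : ∀ {Q J} x → Annihilates (suc Q) J (embed (reduceMod Q x)) → Annihilates (suc Q) J x
  reduceMod⇒Annihilates {Q} x ann j j∈J =
    subst (+ suc Q ∣ℤ_) (sym (reduceMod-ᵥ* Q x j)) (ℤ∣.∣m∣n⇒∣m+n (ann j j∈J) (ℤ∣.∣m⇒∣m*n _ ℤ∣.∣-refl))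

  InH-cong : ∀ {Q} J {x y : Fin m → Fin Q} → (∀ i → x i ≡ y i) → InH C Q J x → InH C Q J y
  InH-cong {Q} J x≗y x∈H j j∈J =
    subst (λ v → Q ∣ ∣ v ∣) (Σℤ-cong (λ i → cong (λ a → + toℕ a * C i j) (x≗y i))) (x∈H j j∈J)

  InH? : ∀ Q J x → Dec (InH C Q J x)
  InH? Q J x = Finₚ.all? (λ j → (lookup J j Bool.≟ true) →-dec (Q ∣? _))

  ⊆H? : ∀ Q J′ J → Dec (J′ ⊆H[ C , Q ] J)
  ⊆H? Q J′ J = ∀-functions? m
    (λ x≗y x∈H′⇒x∈H y∈H′ → InH-cong J x≗y (x∈H′⇒x∈H (InH-cong J′ (sym ∘ x≗y) y∈H′)))
    (λ x → InH? Q J′ x →-dec InH? Q J x)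

  inclusion⇒Annihilates : ∀ {Q J′ J} → J′ ⊆H[ C , suc Q ] J → ∀ X → Annihilates (suc Q) J′ X → Annihilates (suc Q) J X
  inclusion⇒Annihilates {Q} {J′} {J} H′⊆H X X∈H′ =
    reduceMod⇒Annihilates {J = J} X
      (InH⇒Annihilates J x (H′⊆H x (Annihilates⇒InH J′ x (Annihilates⇒reduceMod {J = J′} X X∈H′))))
    where x = reduceMod Q X

  annihilatorIncluded⇒∣ℤ : ∀ {Q e b} → AnnihilatorIncluded Q e ∣ b ∣ → ∀ y → + Q ∣ℤ y * + e → + Q ∣ℤ y * b
  annihilatorIncluded⇒∣ℤ {Q} {e} {b} incl y Q∣ye = ℤ∣.∣ᵤ⇒∣
    (subst (Q ∣_) (sym (ℤₚ.abs-* y b)) (incl ∣ y ∣ (subst (Q ∣_) (ℤₚ.abs-* y (+ e)) (ℤ∣.∣⇒∣ᵤ Q∣ye))))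

  module _ (J′ : Vec Bool n) {S T D} (snf : IsSNFVia (sub C J′) S T D) where

    B : Mat m n
    B = S ⊗ C

    Condition : ℕ → Vec Bool n → Set
    Condition Q J = ∀ j → j ∈J J → ∀ i → AnnihilatorIncluded Q (diagonal D i) ∣ B i j ∣

    xC≡xS⁻¹B : ∀ x j → (x ᵥ* C) j ≡ ((x ᵥ* S⁻¹ snf) ᵥ* B) j
    xC≡xS⁻¹B x j = begin
      (x ᵥ* C) j                       ≡⟨ ᵥ*-congʳ x (⊗-identityˡ C) j ⟨
      (x ᵥ* (idM ⊗ C)) j               ≡⟨ ᵥ*-congʳ x (⊗-congʳ C (proj₂ (proj₂ (proj₁ snf)))) j ⟨
      (x ᵥ* ((S⁻¹ snf ⊗ S) ⊗ C)) j     ≡⟨ ᵥ*-congʳ x (⊗-assoc (S⁻¹ snf) S C) j ⟩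
      (x ᵥ* (S⁻¹ snf ⊗ B)) j           ≡⟨ ᵥ*-assoc x (S⁻¹ snf) B j ⟨
      ((x ᵥ* S⁻¹ snf) ᵥ* B) j          ∎
      where open ≡-Reasoning

    condition⇒inclusion : ∀ Q J → Condition (suc Q) J → J′ ⊆H[ C , suc Q ] J
    condition⇒inclusion Q J cond x x∈H′ = Annihilates⇒InH J x λ j j∈J →
      subst (+ suc Q ∣ℤ_) (sym (xC≡xS⁻¹B X j))
        (∣-Σℤ _ (λ ρ → annihilatorIncluded⇒∣ℤ (cond j j∈J ρ) ((X ᵥ* S⁻¹ snf) ρ) (yE ρ)))
      where
      X = embed x
      yE : ∀ ρ → + suc Q ∣ℤ (X ᵥ* S⁻¹ snf) ρ * + diagonal D ρ
      yE = annihilates⇒ snf X (Annihilates⇒annihilates-sub J′ X (InH⇒Annihilates J′ x x∈H′))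

    unitRow-annihilates : ∀ {Q y} i → Q ∣ y ℕ.* diagonal D i → Annihilates Q J′ (unitRow (+ y) i ᵥ* S)
    unitRow-annihilates {Q} {y} i Q∣yE =
      annihilates-sub⇒Annihilates J′ X
        (annihilates⇐ snf X (λ l → subst (λ z → + Q ∣ℤ z * + diagonal D l) (sym (XS⁻¹≡Y l)) (YE l)))
      where
      Y = unitRow (+ y) i
      X = Y ᵥ* S
      XS⁻¹≡Y : ∀ l → (X ᵥ* S⁻¹ snf) l ≡ Y l
      XS⁻¹≡Y l = trans (ᵥ*-assoc Y S (S⁻¹ snf) l)
                       (trans (ᵥ*-congʳ Y (proj₁ (proj₂ (proj₁ snf))) l) (ᵥ*-identityʳ Y l))
      YE : ∀ l → + Q ∣ℤ Y l * + diagonal D l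
      YE l with l Finₚ.≟ i
      ... | yes refl = subst (λ z → + Q ∣ℤ z * + diagonal D l)
                             (sym (trans (cong (+ y *_) (δ-refl l)) (ℤₚ.*-identityʳ (+ y))))
                             (ℤ∣.∣ᵤ⇒∣ (subst (Q ∣_) (sym (ℤₚ.abs-* (+ y) (+ diagonal D l))) Q∣yE))
      ... | no  l≢i  = subst (+ Q ∣ℤ_)
                             (sym (trans (cong (λ z → + y * z * + diagonal D l) (δ-≢ (l≢i ∘ sym)))
                                         (cong (_* + diagonal D l) (ℤₚ.*-zeroʳ (+ y)))))
                             (ℤ∣.divides 0ℤ refl)

    inclusion⇒condition : ∀ Q J → J′ ⊆H[ C , suc Q ] J → Condition (suc Q) J
    inclusion⇒condition Q J H′⊆H j j∈J i y Q∣yE =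
      subst (suc Q ∣_) ∣XC∣≡y∣B∣
        (ℤ∣.∣⇒∣ᵤ (inclusion⇒Annihilates {J′ = J′} {J} H′⊆H X (unitRow-annihilates {y = y} i Q∣yE) j j∈J))
      where
      X = unitRow (+ y) i ᵥ* S
      ∣XC∣≡y∣B∣ : ∣ (X ᵥ* C) j ∣ ≡ y ℕ.* ∣ B i j ∣
      ∣XC∣≡y∣B∣ = trans (cong ∣_∣ (trans (ᵥ*-assoc (unitRow (+ y) i) S C j) (unitRow-ᵥ* (+ y) i B j)))
                        (ℤₚ.abs-* (+ y) (B i j))

module Periodicity {m n : ℕ} (C : Mat m n) (nonzero : NonzeroColumns C)
                   {ρ₀ : ℕ} (isρ₀ : IsRho0 C ρ₀) {q₀ : ℕ} (isq₀ : IsQ0 C q₀) where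

  open import Relation.Nullary.Decidable using (decidable-stable)
  open import Relation.Nullary.Negation using (¬¬-map)
  open MatrixAlgebra
  open DiagonalForms
  open SmithNormalFormExistence using (smithDecomposition)
  open ElementaryDivisorBound C using (elementaryDivisors∣ρ₀)
  open AnnihilatorInclusion using (annihilatorIncluded-periodic)
  open HyperplaneConditions C
  open FiniteSearch

  BoundedSNF : Vec Bool n → Set
  BoundedSNF J′ = ∃ λ S → AdmissibleS C J′ S × (∀ i j → ∣ (S ⊗ C) i j ∣ ≤ q₀)

  C-bounded : ∀ i j → ∣ C i j ∣ ≤ q₀
  C-bounded i j with proj₂ isq₀ (ℕₚ.≤-trans (s≤s z≤n) (Finₚ.toℕ<n j))
  ... | _ , _ , (_ , _ , maxEntry) , _ = proj₂ (proj₁ maxEntry i j)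

  boundedSNF-empty : ∀ J′ → card J′ ≡ 0 → BoundedSNF J′
  boundedSNF-empty J′ |J′|≡0 =
    idM , (idM , zeroSNF , Unimodular-idM , Unimodular-idM , λ i k → ⊥-elim (Fin0-empty (subst Fin |J′|≡0 k))) ,
    λ i j → subst (_≤ q₀) (sym (cong ∣_∣ (⊗-identityˡ C i j))) (C-bounded i j)
    where
    Fin0-empty : ¬ Fin 0
    Fin0-empty ()

  -- Only a cheapest admissible S is known to satisfy the bound q₀; its existence is classical,
  -- whence the double negation.
  boundedSNF-nonempty : ∀ J′ → 1 ≤ card J′ → ¬ ¬ BoundedSNF J′
  boundedSNF-nonempty J′ 1≤|J′| = ¬¬-map bounded (¬¬-least Cost (S , admissible , proj₂ (maxEntry C S i₀ j₀)))
    where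
    Cost : ℕ → Set
    Cost w = ∃ λ S → AdmissibleS C J′ S × MaxEntry C S w
    S = proj₁ (smithDecomposition (sub C J′))
    admissible : AdmissibleS C J′ S
    admissible = proj₂ (smithDecomposition (sub C J′))
    j₀ = sel J′ (fromℕ< 1≤|J′|)
    i₀ = nonzeroColumn⇒row C j₀ (nonzero j₀)
    bounded : (∃ λ w → Cost w × ∀ v → Cost v → w ≤ v) → BoundedSNF J′
    bounded (w , (S′ , admissible′ , cost) , cheapest) =
      S′ , admissible′ , λ i j → ℕₚ.≤-trans (proj₁ (proj₁ cost i j)) w≤q₀
      where
      w≤q₀ : w ≤ q₀
      w≤q₀ = proj₁ isq₀ J′ w 1≤|J′| ((S′ , admissible′ , cost) , λ S v adm c → cheapest v (S , adm , c))

  boundedSNF : ∀ J′ → ¬ ¬ BoundedSNF J′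
  boundedSNF J′ with card J′ ℕ.≟ 0
  ... | yes |J′|≡0 = λ ¬bounded → ¬bounded (boundedSNF-empty J′ |J′|≡0)
  ... | no  |J′|≢0 = boundedSNF-nonempty J′ (ℕₚ.n≢0⇒n>0 |J′|≢0)

  diagonal≡0⊎∣ρ₀ : ∀ J′ {S T D} → IsSNFVia (sub C J′) S T D → ∀ ρ → diagonal D ρ ≡ 0 ⊎ diagonal D ρ ∣ ρ₀
  diagonal≡0⊎∣ρ₀ J′ {S} {T} {D} snf ρ with inject≤-or-beyond (SNFData.ℓ≤m D) ρ
  ... | inj₁ (i , refl) = inj₂ (subst (_∣ ρ₀) (sym (diagonal-ι D i)) (elementaryDivisors∣ρ₀ isρ₀ J′ S T D snf i))
  ... | inj₂ ρ≮ℓ        = inj₁ (diagonal-beyondRank D ρ ρ≮ℓ)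

  condition-periodic : ∀ J′ {S T D} (snf : IsSNFVia (sub C J′) S T D) → (∀ i j → ∣ (S ⊗ C) i j ∣ ≤ q₀) →
    ∀ {q} s → q₀ < q → ∀ J → Condition J′ snf q J ⇔ Condition J′ snf (q ℕ.+ s ℕ.* ρ₀) J
  condition-periodic J′ snf bounded s q₀<q J = mk⇔
    (λ cond j j∈J i → Equivalence.to   (periodic i j) (cond j j∈J i))
    (λ cond j j∈J i → Equivalence.from (periodic i j) (cond j j∈J i))
    where
    periodic = λ i j → annihilatorIncluded-periodic s q₀<q (bounded i j) (diagonal≡0⊎∣ρ₀ J′ snf i)

  ⊆H-transfer : ∀ {Q Q′} J′ J →
    (∀ {S T D} (snf : IsSNFVia (sub C J′) S T D) → (∀ i j → ∣ (S ⊗ C) i j ∣ ≤ q₀) →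
       Condition J′ snf (suc Q) J → Condition J′ snf (suc Q′) J) →
    J′ ⊆H[ C , suc Q ] J → J′ ⊆H[ C , suc Q′ ] J
  ⊆H-transfer {Q} {Q′} J′ J transfer H′⊆H = decidable-stable (⊆H? (suc Q′) J′ J) (¬¬-map via (boundedSNF J′))
    where
    via : BoundedSNF J′ → J′ ⊆H[ C , suc Q′ ] J
    via (S , (T , D , snf) , bounded) =
      condition⇒inclusion J′ snf Q′ J (transfer snf bounded (inclusion⇒condition J′ snf Q J H′⊆H))

  inclusion-periodic : ∀ q s → q₀ < q → ∀ J′ J → J′ ⊆H[ C , q ℕ.+ s ℕ.* ρ₀ ] J ⇔ J′ ⊆H[ C , q ] J
  inclusion-periodic (suc q) s q₀<q J′ J = mk⇔
    (⊆H-transfer J′ J (λ snf bounded → Equivalence.from (condition-periodic J′ snf bounded s q₀<q J)))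
    (⊆H-transfer J′ J (λ snf bounded → Equivalence.to   (condition-periodic J′ snf bounded s q₀<q J)))

open import Data.Nat using (ℕ; _+_; _*_; _<_)

corollary3p3 : (m n : ℕ) (C : Mat m n) → NonzeroColumns C →
    (ρ₀ : ℕ) → IsRho0 C ρ₀ → (q₀ : ℕ) → IsQ0 C q₀ →
    (q s : ℕ) → q₀ < q → LatticeIso C (q + s * ρ₀) q
corollary3p3 m n C nonzero ρ₀ isρ₀ q₀ isq₀ q s q₀<q =
  (λ J → J) , (λ J J′ → Equivalence.to (inclusion J′ J) , Equivalence.from (inclusion J′ J)) ,
  (λ K → K , (λ x x∈H → x∈H) , (λ x x∈H → x∈H))
  where
  inclusion = Periodicity.inclusion-periodic C nonzero isρ₀ isq₀ q s q₀<q
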